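{- Let $Q=\prod_{i=1}^{n}Q_i$ be a product gate at the second layer from the top in a homogeneous $\Sigma\Pi\Sigma\Pi^{\{s\}}$ circuit computing a homogeneous degree-$n$ polynomial in $N$ variables. For any positive integers $m,r,s,\ell$ satisfying $m+rs\le N/2$ and $m+rs\le \ell/2$, $$\mathrm{Dim}\big(\langle\partial^{r}Q\rangle_{(\ell,m)}\big)\le \mathrm{poly}(nrs)\binom{n+r}{r}\binom{N}{m+rs}\binom{\ell+n-r}{m+rs},$$ where $\mathrm{poly}(nrs)$ denotes a factor bounded by a fixed polynomial in $nrs$.
   Context: A homogeneous $\Sigma\Pi\Sigma\Pi$ circuit computing a homogeneous polynomial of degree $n$ has the form $\sum_{i=1}^T\prod_j Q_{i,j}$ with each $Q_{i,j}$ homogeneous and $\sum_j \deg Q_{i,j}=n$; the products $\prod_j Q_{i,j}$ are the product gates at the second layer from the top, and the bottom product gates compute the monomials of the $Q_{i,j}$. It is a $\Sigma\Pi\Sigma\Pi^{\{s\}}$ circuit if every monomial of every $Q_{i,j}$ has support (set of variables with positive exponent) of size at most $s$. For a polynomial $P$ in variables $x_1,\dots,x_N$, $\partial^rP$ is the set of all partial derivatives of $P$ of order exactly $r$. The space of support-$m$ degree-$\ell$ shifted partial derivatives of order $r$ is $\langle\partial^rP\rangle_{(\ell,m)}=\mathbb{F}\text{ -span}\{\gamma\cdot g:\ g\in\partial^rP,\ \gamma \text{ a monomial of degree } \ell \text{ whose support has size exactly } m\}$, and $\mathrm{Dim}$ denotes dimension over the field. -}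

module Defs where

open import Level using (Level; _⊔_) renaming (suc to lsuc)
open import Algebra.Bundles using (CommutativeRing)
open import Data.Nat as ℕ using (ℕ; zero; suc; _≤_; pred)
open import Data.Nat.Properties as ℕₚ using ()
open import Data.Fin using (Fin)
open import Data.Vec as Vec using (Vec; lookup; _[_]%=_; zipWith; replicate)
open import Data.Vec.Properties using (≡-dec)
open import Data.List as List using (List; []; _∷_; _++_; map; concatMap; length; foldr)
open import Data.List.Relation.Unary.All using (All)
open import Data.Product using (Σ; ∃; _×_; _,_; proj₁; proj₂)
open import Relation.Nullary using (¬_; yes; no)
open import Relation.Binary.PropositionalEquality using (_≡_)

record Field (a b : Level) : Set (lsuc (a ⊔ b)) where
  field
    commutativeRing : CommutativeRing a b
  open CommutativeRing commutativeRing public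
  field
    0≉1     : ¬ (0# ≈ 1#)
    inverse : ∀ x → ¬ (x ≈ 0#) → ∃ λ y → (x * y) ≈ 1#

module Poly {a b : Level} (F : Field a b) (N : ℕ) where
  open Field F

  Monomial : Set
  Monomial = Vec ℕ N

  -- a polynomial is a finite formal sum of terms c·x^β (list of terms);
  -- its coefficients are obtained by collecting like terms (see coeff)
  Polynomial : Set a
  Polynomial = List (Monomial × Carrier)

  coeff : Polynomial → Monomial → Carrier
  coeff []            α = 0#
  coeff ((β , c) ∷ p) α with ≡-dec ℕ._≟_ β α
  ... | yes _ = c + coeff p α
  ... | no  _ = coeff p α

  _≋_ : Polynomial → Polynomial → Set b
  p ≋ q = ∀ α → coeff p α ≈ coeff q α

  0P : Polynomial
  0P = []

  _+P_ : Polynomial → Polynomial → Polynomial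
  _+P_ = _++_

  scale : Carrier → Polynomial → Polynomial
  scale c = map (λ t → proj₁ t , c * proj₂ t)

  _*P_ : Polynomial → Polynomial → Polynomial
  p *P q = concatMap (λ t → map (λ u → zipWith ℕ._+_ (proj₁ t) (proj₁ u) , proj₂ t * proj₂ u) q) p

  1P : Polynomial
  1P = (replicate N 0 , 1#) ∷ []

  prodP : List Polynomial → Polynomial
  prodP = foldr _*P_ 1P

  mono : Monomial → Polynomial
  mono γ = (γ , 1#) ∷ []

  deg : Monomial → ℕ
  deg = Vec.sum

  supportSize : ∀ {k} → Vec ℕ k → ℕ
  supportSize Vec.[]           = 0
  supportSize (zero  Vec.∷ γ)  = supportSize γ
  supportSize (suc _ Vec.∷ γ)  = suc (supportSize γ)

  natMul : ℕ → Carrier → Carrier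
  natMul zero    c = 0#
  natMul (suc k) c = c + natMul k c

  ∂ : Fin N → Polynomial → Polynomial
  ∂ i = map (λ t → (proj₁ t [ i ]%= pred) , natMul (lookup (proj₁ t) i) (proj₂ t))

  ∂* : ∀ {r} → Vec (Fin N) r → Polynomial → Polynomial
  ∂* is P = Vec.foldr _ ∂ P is

  IsHomogeneous : ℕ → Polynomial → Set b
  IsHomogeneous d p = ∀ α → ¬ (coeff p α ≈ 0#) → deg α ≡ d

  SupportAtMost : ℕ → Polynomial → Set b
  SupportAtMost s p = ∀ α → ¬ (coeff p α ≈ 0#) → supportSize α ≤ s

  lincomb : List (Carrier × Polynomial) → Polynomial
  lincomb = foldr (λ t acc → scale (proj₁ t) (proj₂ t) +P acc) 0P

  LinIndep : List Polynomial → Set (a ⊔ b)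
  LinIndep vs = (cs : List Carrier) → length cs ≡ length vs →
                lincomb (List.zip cs vs) ≋ 0P → All (λ c → c ≈ 0#) cs

  -- membership in ⟨∂^r P⟩_(ℓ,m): a finite linear combination of γ · ∂_{i⃗} P
  -- with γ a monomial of degree ℓ and support size exactly m, i⃗ ∈ [N]^r
  InShiftedSpan : (r ℓ m : ℕ) → Polynomial → Polynomial → Set (a ⊔ b)
  InShiftedSpan r ℓ m P v =
    Σ (List (Carrier × Monomial × Vec (Fin N) r)) λ L →
      All (λ t → deg (proj₁ (proj₂ t)) ≡ ℓ × supportSize (proj₁ (proj₂ t)) ≡ m) L ×
      (v ≋ lincomb (map (λ t → proj₁ t , (mono (proj₁ (proj₂ t)) *P ∂* (proj₂ (proj₂ t)) P)) L))

  -- Dim(V) ≤ B for a subspace V (given by a membership predicate):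
  -- every linearly independent family in V has at most B elements
  DimAtMost : (Polynomial → Set (a ⊔ b)) → ℕ → Set (a ⊔ b)
  DimAtMost V B = (vs : List Polynomial) → All V vs → LinIndep vs → length vs ≤ B

-- By the product rule, an r-th order partial derivative of Q = Q₁ ⋯ Qₙ is a linear combination of products
-- x^μ · ∏_{i ∉ S} Qᵢ, where the set S of at most r factors absorbed the derivatives, deg μ = Σ_{i ∈ S} dᵢ − r and,
-- as every monomial of a factor has support at most s, #supp μ ≤ s·|S| ≤ rs. After a shift by x^γ with deg γ = ℓ and
-- #supp γ = m, all of ⟨∂^r Q⟩_(ℓ,m) therefore lies in the span of the products x^ν · ∏_{i ∉ S} Qᵢ with
-- deg ν = ℓ + Σ_{i ∈ S} dᵢ − r ≤ ℓ + n − r and m ≤ #supp ν ≤ m + rs. There are at most C(n+r, r) such S, at most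
-- 1 + nrs support sizes, and for each size t at most C(N, t)·C(deg ν, t) ≤ C(N, m+rs)·C(ℓ+n−r, m+rs) exponents ν,
-- the last step because m + rs lies below both N/2 and ℓ/2. A linearly independent family inside the span of K
-- vectors has at most K members (Gaussian elimination), so poly(nrs) = 1 + nrs works. Equality in the field is not
-- decidable, so the elimination, and the removal of cancelling terms from the factors, take place in the
-- double-negation monad; the bound itself is a decidable statement about ℕ and is recovered at the end.

module Submission where

open import Level using (Level; _⊔_)
open import Data.Bool using (Bool; true; false)
open import Data.Empty using (⊥; ⊥-elim)
open import Data.Unit using (⊤; tt)
open import Data.Nat using (ℕ; zero; suc; pred; _≤_; _<_; z≤n; s≤s; _≤?_)
import Data.Nat as Nat
import Data.Nat.Properties as ℕₚ
open import Data.Nat.Combinatorics using (_C_; nCk+nC[k+1]≡[n+1]C[k+1]; nCn≡1; nC1≡n)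
open import Data.Nat.ListAction using (sum)
open import Data.Nat.Tactic.RingSolver using (solve-∀)
open import Data.Fin using (Fin; zero; suc)
open import Data.Vec as Vec using (Vec; []; _∷_; _[_]%=_)
import Data.Vec.Properties as Vecₚ
open import Data.List as List using (List; []; _∷_; _++_; map; concatMap; length; downFrom)
import Data.List.Properties as Listₚ
open import Data.List.Relation.Unary.All as All using (All; []; _∷_)
import Data.List.Relation.Unary.All.Properties as Allₚ
open import Data.List.Relation.Unary.Any as Any using (Any; here; there; any?)
open import Data.List.Relation.Unary.Any.Properties using (lookup-index)
open import Data.List.Membership.Propositional using (_∈_; lose)
open import Data.List.Membership.Propositional.Properties
  using (∈-map⁺; ∈-map⁻; ∈-++⁺ˡ; ∈-++⁺ʳ; ∈-concatMap⁺; ∈-filter⁺; ∈-filter⁻; ∈-downFrom⁺; ∈-downFrom⁻)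
open import Data.Product using (Σ; ∃; ∃₂; _×_; _,_; proj₁; proj₂)
open import Data.Sum as Sum using (_⊎_; inj₁; inj₂)
open import Function using (_∘_)
open import Relation.Nullary using (¬_; yes; no; Dec; _×-dec_)
open import Relation.Nullary.Negation using (contradiction; ¬¬-map; negated-stable)
open import Relation.Nullary.Decidable using (¬¬-excluded-middle; decidable-stable)
open import Relation.Unary using (Decidable)
open import Relation.Binary.PropositionalEquality as ≡ using (_≡_; _≢_)
open import Defs

private variable
  ℓ ℓ′ : Level

¬¬-intro : {A : Set ℓ} → A → ¬ ¬ A
¬¬-intro = contradiction

infixl 1 _¬¬>>=_
_¬¬>>=_ : {A : Set ℓ} {B : Set ℓ′} → ¬ ¬ A → (A → ¬ ¬ B) → ¬ ¬ B
x ¬¬>>= f = negated-stable (¬¬-map f x)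

¬¬-All : ∀ {A : Set ℓ} {P : A → Set ℓ′} (xs : List A) → (∀ x → ¬ ¬ P x) → ¬ ¬ All P xs
¬¬-All []       ¬¬P = ¬¬-intro []
¬¬-All (x ∷ xs) ¬¬P = ¬¬P x ¬¬>>= λ px → ¬¬-map (px ∷_) (¬¬-All xs ¬¬P)

¬¬-∀⊎∃¬ : ∀ {p} (P : Fin p → Set ℓ) → ¬ ¬ ((∀ j → P j) ⊎ ∃ λ j → ¬ P j)
¬¬-∀⊎∃¬ {p = zero}  P = ¬¬-intro (inj₁ λ ())
¬¬-∀⊎∃¬ {p = suc p} P = ¬¬-excluded-middle ¬¬>>= λ where
  (no ¬P₀) → ¬¬-intro (inj₂ (zero , ¬P₀))
  (yes P₀) → ¬¬-∀⊎∃¬ (P ∘ suc) ¬¬>>= λ where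
    (inj₁ ∀P)        → ¬¬-intro (inj₁ λ { zero → P₀ ; (suc j) → ∀P j })
    (inj₂ (j , ¬Pj)) → ¬¬-intro (inj₂ (suc j , ¬Pj))

module _ where
  open import Data.Nat using (_+_; _*_; _∸_)
  open ≡ using (refl; sym; trans; cong; cong₂; subst; subst₂; module ≡-Reasoning)

  binomial : ℕ → ℕ → ℕ
  binomial n       zero    = 1
  binomial zero    (suc k) = 0
  binomial (suc n) (suc k) = binomial n k + binomial n (suc k)

  binomial≡C : ∀ n k → binomial n k ≡ n C k
  binomial≡C n       zero    = refl
  binomial≡C zero    (suc k) = refl
  binomial≡C (suc n) (suc k) =
    trans (cong₂ _+_ (binomial≡C n k) (binomial≡C n (suc k))) (nCk+nC[k+1]≡[n+1]C[k+1] n k)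

  binomial-diag : ∀ n → binomial n n ≡ 1
  binomial-diag n = trans (binomial≡C n n) (nCn≡1 n)

  -- (k + 1)·C(n, k + 1) = (n − k)·C(n, k), stated without truncated subtraction.
  binomial-absorption : ∀ n k → suc k * binomial n (suc k) + k * binomial n k ≡ n * binomial n k
  binomial-absorption zero    zero    = refl
  binomial-absorption zero    (suc k) = cong₂ _+_ (ℕₚ.*-zeroʳ (2 + k)) (ℕₚ.*-zeroʳ (suc k))
  binomial-absorption (suc n) zero    = begin
    1 * suc (binomial n 1) + 0 ≡⟨ cong (λ b → 1 * suc b + 0) (trans (binomial≡C n 1) (nC1≡n n)) ⟩
    1 * suc n + 0              ≡⟨ tidy n ⟩
    suc n * 1                  ∎
    where
    open ≡-Reasoning
    tidy : ∀ n → 1 * suc n + 0 ≡ suc n * 1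
    tidy = solve-∀
  binomial-absorption (suc n) (suc k) = begin
    (2 + k) * (y + z) + suc k * (x + y)                         ≡⟨ regroup k x y z ⟩
    ((2 + k) * z + suc k * y) + (suc k * y + k * x) + (x + y)  ≡⟨ cong₂ (λ u v → u + v + (x + y))
                                                                      (binomial-absorption n (suc k))
                                                                      (binomial-absorption n k) ⟩
    n * y + n * x + (x + y)                                      ≡⟨ collect n x y ⟩
    suc n * (x + y)                                              ∎
    where
    open ≡-Reasoning
    x = binomial n k
    y = binomial n (suc k)
    z = binomial n (2 + k)
    regroup : ∀ k x y z → (2 + k) * (y + z) + suc k * (x + y) ≡ ((2 + k) * z + suc k * y) + (suc k * y + k * x) + (x + y)
    regroup = solve-∀
    collect : ∀ n x y → n * y + n * x + (x + y) ≡ suc n * (x + y)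
    collect = solve-∀

  binomial-< : ∀ {n k} → 2 * k < n → binomial n k ≤ binomial n (suc k)
  binomial-< {n} {k} 2k<n = ℕₚ.*-cancelˡ-≤ (suc k) (ℕₚ.+-cancelʳ-≤ (k * b) (suc k * b) (suc k * binomial n (suc k)) ineq)
    where
    b = binomial n k
    split : ∀ k b → suc (2 * k) * b ≡ suc k * b + k * b
    split = solve-∀
    ineq : suc k * b + k * b ≤ suc k * binomial n (suc k) + k * b
    ineq = subst₂ _≤_ (split k b) (sym (binomial-absorption n k)) (ℕₚ.*-monoˡ-≤ b 2k<n)

  binomial-monoʳ-≤ : ∀ {n k K} → k ≤ K → 2 * K ≤ n → binomial n k ≤ binomial n K
  binomial-monoʳ-≤ {K = K} k≤K 2K≤n with ℕₚ.m≤n⇒m<n∨m≡n k≤K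
  binomial-monoʳ-≤ {K = suc K} _ 2K≤n | inj₁ (s≤s k≤K) =
    ℕₚ.≤-trans (binomial-monoʳ-≤ k≤K 2K′≤n) (binomial-< (ℕₚ.<-≤-trans (ℕₚ.*-monoʳ-< 2 ℕₚ.≤-refl) 2K≤n))
    where 2K′≤n = ℕₚ.≤-trans (ℕₚ.*-monoʳ-≤ 2 (ℕₚ.n≤1+n K)) 2K≤n
  binomial-monoʳ-≤ _ _ | inj₂ refl = ℕₚ.≤-refl

  binomial-monoˡ-≤ : ∀ {n n′} k → n ≤ n′ → binomial n k ≤ binomial n′ k
  binomial-monoˡ-≤ zero    _         = ℕₚ.≤-refl
  binomial-monoˡ-≤ (suc k) z≤n       = z≤n
  binomial-monoˡ-≤ {suc n} {suc n′} (suc k) (s≤s n≤n′) = ℕₚ.+-mono-≤ (binomial-monoˡ-≤ k n≤n′) (binomial-monoˡ-≤ (suc k) n≤n′)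

  sum-binomial-downFrom : ∀ D t c → sum (map (λ j → c * binomial j t) (downFrom D)) ≡ c * binomial D (suc t)
  sum-binomial-downFrom zero    t c = sym (ℕₚ.*-zeroʳ c)
  sum-binomial-downFrom (suc D) t c =
    trans (cong (c * binomial D t +_) (sum-binomial-downFrom D t c)) (sym (ℕₚ.*-distribˡ-+ c (binomial D t) (binomial D (suc t))))

  length-concatMap-≤ : ∀ {x y} {X : Set x} {Y : Set y} (f : X → List Y) (g : X → ℕ) xs →
                       (∀ u → length (f u) ≤ g u) → length (concatMap f xs) ≤ sum (map g xs)
  length-concatMap-≤ f g []       _ = z≤n
  length-concatMap-≤ f g (u ∷ xs) h =
    ℕₚ.≤-trans (ℕₚ.≤-reflexive (Listₚ.length-++ (f u))) (ℕₚ.+-mono-≤ (h u) (length-concatMap-≤ f g xs h))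

  length-concatMap-≤-* : ∀ {x y} {X : Set x} {Y : Set y} (f : X → List Y) M xs →
                         (∀ u → u ∈ xs → length (f u) ≤ M) → length (concatMap f xs) ≤ length xs * M
  length-concatMap-≤-* f M []       _ = z≤n
  length-concatMap-≤-* f M (u ∷ xs) h = ℕₚ.≤-trans (ℕₚ.≤-reflexive (Listₚ.length-++ (f u)))
    (ℕₚ.+-mono-≤ (h u (here refl)) (length-concatMap-≤-* f M xs (λ v v∈xs → h v (there v∈xs))))

  _⊕_ : ∀ {n} → Vec ℕ n → Vec ℕ n → Vec ℕ n
  _⊕_ = Vec.zipWith _+_

  ⊕-comm : ∀ {n} (u v : Vec ℕ n) → u ⊕ v ≡ v ⊕ u
  ⊕-comm = Vecₚ.zipWith-comm ℕₚ.+-comm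

  ⊕-assoc : ∀ {n} (u v w : Vec ℕ n) → (u ⊕ v) ⊕ w ≡ u ⊕ (v ⊕ w)
  ⊕-assoc = Vecₚ.zipWith-assoc ℕₚ.+-assoc

  ⊕-identityˡ : ∀ {n} (u : Vec ℕ n) → Vec.replicate n 0 ⊕ u ≡ u
  ⊕-identityˡ = Vecₚ.zipWith-identityˡ ℕₚ.+-identityˡ

  ⊕-∸ : ∀ {n} (g u α : Vec ℕ n) → g ⊕ u ≡ α → Vec.zipWith _∸_ α g ≡ u
  ⊕-∸ []      []      []      _  = refl
  ⊕-∸ (x ∷ g) (y ∷ u) (z ∷ α) eq with Vecₚ.∷-injective eq
  ... | refl , eq′ = cong₂ _∷_ (ℕₚ.m+n∸m≡n x y) (⊕-∸ g u α eq′)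

  #nonzero : ∀ {n} → Vec ℕ n → ℕ
  #nonzero []          = 0
  #nonzero (zero  ∷ v) = #nonzero v
  #nonzero (suc _ ∷ v) = suc (#nonzero v)

  #nonzero-⊕ : ∀ {n} (u v : Vec ℕ n) → #nonzero (u ⊕ v) ≤ #nonzero u + #nonzero v
  #nonzero-⊕ []          []          = z≤n
  #nonzero-⊕ (zero  ∷ u) (zero  ∷ v) = #nonzero-⊕ u v
  #nonzero-⊕ (zero  ∷ u) (suc _ ∷ v) =
    subst (suc (#nonzero (u ⊕ v)) ≤_) (sym (ℕₚ.+-suc (#nonzero u) (#nonzero v))) (s≤s (#nonzero-⊕ u v))
  #nonzero-⊕ (suc _ ∷ u) (y     ∷ v) = s≤s (ℕₚ.≤-trans (#nonzero-⊕ u v) (ℕₚ.+-monoʳ-≤ (#nonzero u) (#nonzero-∷ y v)))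
    where
    #nonzero-∷ : ∀ {n} y (v : Vec ℕ n) → #nonzero v ≤ #nonzero (y ∷ v)
    #nonzero-∷ zero    v = ℕₚ.≤-refl
    #nonzero-∷ (suc y) v = ℕₚ.n≤1+n _

  #nonzero-⊕ˡ : ∀ {n} (u v : Vec ℕ n) → #nonzero u ≤ #nonzero (u ⊕ v)
  #nonzero-⊕ˡ []          []          = z≤n
  #nonzero-⊕ˡ (zero  ∷ u) (zero  ∷ v) = #nonzero-⊕ˡ u v
  #nonzero-⊕ˡ (zero  ∷ u) (suc _ ∷ v) = ℕₚ.m≤n⇒m≤1+n (#nonzero-⊕ˡ u v)
  #nonzero-⊕ˡ (suc _ ∷ u) (_     ∷ v) = s≤s (#nonzero-⊕ˡ u v)

  #nonzero-zeros : ∀ n → #nonzero (Vec.replicate n 0) ≡ 0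
  #nonzero-zeros zero    = refl
  #nonzero-zeros (suc n) = #nonzero-zeros n

  sum-⊕ : ∀ {n} (u v : Vec ℕ n) → Vec.sum (u ⊕ v) ≡ Vec.sum u + Vec.sum v
  sum-⊕ []      []      = refl
  sum-⊕ (x ∷ u) (y ∷ v) = trans (cong (x + y +_) (sum-⊕ u v)) (interchange x y (Vec.sum u) (Vec.sum v))
    where
    interchange : ∀ x y p q → (x + y) + (p + q) ≡ (x + p) + (y + q)
    interchange = solve-∀

  sum-zeros : ∀ n → Vec.sum (Vec.replicate n 0) ≡ 0
  sum-zeros zero    = refl
  sum-zeros (suc n) = sum-zeros n

  monomials : (n t D : ℕ) → List (Vec ℕ n)
  monomials zero    zero    zero    = [] ∷ []
  monomials zero    zero    (suc D) = []
  monomials zero    (suc t) D       = []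
  monomials (suc n) zero    D       = map (0 ∷_) (monomials n zero D)
  monomials (suc n) (suc t) D       =
    map (0 ∷_) (monomials n (suc t) D) ++ concatMap (λ j → map (D ∸ j ∷_) (monomials n t j)) (downFrom D)

  ∈-monomials : ∀ {n} (v : Vec ℕ n) → v ∈ monomials n (#nonzero v) (Vec.sum v)
  ∈-monomials [] = here refl
  ∈-monomials {suc n} (zero ∷ v) with #nonzero v | ∈-monomials v
  ... | zero  | v∈ = ∈-map⁺ (0 ∷_) v∈
  ... | suc t | v∈ = ∈-++⁺ˡ (∈-map⁺ (0 ∷_) v∈)
  ∈-monomials {suc n} (suc x ∷ v) = ∈-++⁺ʳ (map (0 ∷_) (monomials n (suc (#nonzero v)) D))
    (∈-concatMap⁺ (λ j → map (D ∸ j ∷_) (monomials n (#nonzero v) j)) (lose (∈-downFrom⁺ v<D)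
      (subst (λ h → suc x ∷ v ∈ map (h ∷_) (monomials n (#nonzero v) (Vec.sum v)))
        (sym (ℕₚ.m+n∸n≡m (suc x) (Vec.sum v))) (∈-map⁺ (suc x ∷_) (∈-monomials v)))))
    where
    D = suc x + Vec.sum v
    v<D : Vec.sum v < D
    v<D = s≤s (ℕₚ.m≤n+m (Vec.sum v) x)

  length-monomials : ∀ n t D → length (monomials n t D) ≤ binomial n t * binomial D t
  length-monomials zero    zero    zero    = ℕₚ.≤-refl
  length-monomials zero    zero    (suc D) = z≤n
  length-monomials zero    (suc t) D       = z≤n
  length-monomials (suc n) zero    D       =
    ℕₚ.≤-trans (ℕₚ.≤-reflexive (Listₚ.length-map _ (monomials n zero D))) (length-monomials n zero D)
  length-monomials (suc n) (suc t) D       = begin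
    length (map (0 ∷_) (monomials n (suc t) D) ++ concatMap tail (downFrom D))
      ≡⟨ Listₚ.length-++ (map (0 ∷_) (monomials n (suc t) D)) ⟩
    length (map (0 ∷_) (monomials n (suc t) D)) + length (concatMap tail (downFrom D))
      ≡⟨ cong (_+ length (concatMap tail (downFrom D))) (Listₚ.length-map _ (monomials n (suc t) D)) ⟩
    length (monomials n (suc t) D) + length (concatMap tail (downFrom D))
      ≤⟨ ℕₚ.+-mono-≤ (length-monomials n (suc t) D) (length-concatMap-≤ tail (λ j → binomial n t * binomial j t) (downFrom D) length-tail) ⟩
    binomial n (suc t) * binomial D (suc t) + sum (map (λ j → binomial n t * binomial j t) (downFrom D))
      ≡⟨ cong (binomial n (suc t) * binomial D (suc t) +_) (sum-binomial-downFrom D t (binomial n t)) ⟩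
    binomial n (suc t) * binomial D (suc t) + binomial n t * binomial D (suc t)
      ≡⟨ sym (ℕₚ.*-distribʳ-+ (binomial D (suc t)) (binomial n (suc t)) (binomial n t)) ⟩
    (binomial n (suc t) + binomial n t) * binomial D (suc t)
      ≡⟨ cong (_* binomial D (suc t)) (ℕₚ.+-comm (binomial n (suc t)) (binomial n t)) ⟩
    binomial (suc n) (suc t) * binomial D (suc t) ∎
    where
    open ℕₚ.≤-Reasoning
    tail : ℕ → List (Vec ℕ (suc n))
    tail j = map (D ∸ j ∷_) (monomials n t j)
    length-tail : ∀ j → length (tail j) ≤ binomial n t * binomial j t
    length-tail j = ℕₚ.≤-trans (ℕₚ.≤-reflexive (Listₚ.length-map _ (monomials n t j))) (length-monomials n t j)

  -- lower leaves a zero exponent at zero (pred 0 = 0).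
  lower raise : ∀ {n} → Vec ℕ n → Fin n → Vec ℕ n
  lower v i = v [ i ]%= pred
  raise v i = v [ i ]%= suc

  lower-raise : ∀ {n} (v : Vec ℕ n) i → lower (raise v i) i ≡ v
  lower-raise v i = trans (Vecₚ.[]%=-∘ v i) (Vecₚ.[]%=-id v i)

  raise-lower : ∀ {n} (v : Vec ℕ n) i {k} → Vec.lookup v i ≡ suc k → raise (lower v i) i ≡ v
  raise-lower v i v[i]≡1+k = trans (Vecₚ.[]%=-∘ v i) (Vecₚ.updateAt-id-local i v (trans (cong (λ (m : ℕ) → suc (pred m)) v[i]≡1+k) (sym v[i]≡1+k)))

  sum-lower : ∀ {n} (v : Vec ℕ n) i {k} → Vec.lookup v i ≡ suc k → suc (Vec.sum (lower v i)) ≡ Vec.sum v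
  sum-lower (suc x ∷ v) zero    refl = refl
  sum-lower (x     ∷ v) (suc i) eq   = trans (sym (ℕₚ.+-suc x _)) (cong (x +_) (sum-lower v i eq))

  #nonzero-lower : ∀ {n} (v : Vec ℕ n) i → #nonzero (lower v i) ≤ #nonzero v
  #nonzero-lower (zero          ∷ v) zero    = ℕₚ.≤-refl
  #nonzero-lower (suc zero      ∷ v) zero    = ℕₚ.n≤1+n _
  #nonzero-lower (suc (suc x)   ∷ v) zero    = ℕₚ.≤-refl
  #nonzero-lower (zero          ∷ v) (suc i) = #nonzero-lower v i
  #nonzero-lower (suc x         ∷ v) (suc i) = s≤s (#nonzero-lower v i)

  lower-⊕ˡ-or-zero : ∀ {n} (u v : Vec ℕ n) i → lower (u ⊕ v) i ≡ lower u i ⊕ v ⊎ Vec.lookup u i ≡ 0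
  lower-⊕ˡ-or-zero (zero  ∷ u) (y ∷ v) zero    = inj₂ refl
  lower-⊕ˡ-or-zero (suc x ∷ u) (y ∷ v) zero    = inj₁ refl
  lower-⊕ˡ-or-zero (x     ∷ u) (y ∷ v) (suc i) = Sum.map₁ (cong (x + y ∷_)) (lower-⊕ˡ-or-zero u v i)

  lower-⊕ʳ-or-zero : ∀ {n} (u v : Vec ℕ n) i → lower (u ⊕ v) i ≡ u ⊕ lower v i ⊎ Vec.lookup v i ≡ 0
  lower-⊕ʳ-or-zero (x ∷ u) (zero  ∷ v) zero    = inj₂ refl
  lower-⊕ʳ-or-zero (x ∷ u) (suc y ∷ v) zero    = inj₁ (cong (λ m → pred m ∷ u ⊕ v) (ℕₚ.+-suc x y))
  lower-⊕ʳ-or-zero (x ∷ u) (y     ∷ v) (suc i) = Sum.map₁ (cong (x + y ∷_)) (lower-⊕ʳ-or-zero u v i)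

  -- A selection marks the factors of a product that have been differentiated at least once.
  #selected : List Bool → ℕ
  #selected []          = 0
  #selected (true  ∷ σ) = suc (#selected σ)
  #selected (false ∷ σ) = #selected σ

  module _ {A : Set ℓ} where
    unselected : List Bool → List (ℕ × A) → List A
    unselected []          Qs             = map proj₂ Qs
    unselected (_ ∷ _)     []             = []
    unselected (true  ∷ σ) (_ ∷ Qs)       = unselected σ Qs
    unselected (false ∷ σ) ((_ , q) ∷ Qs) = q ∷ unselected σ Qs

    selectedDegree : List Bool → List (ℕ × A) → ℕ
    selectedDegree (true  ∷ σ) ((d , _) ∷ Qs) = d + selectedDegree σ Qs
    selectedDegree (false ∷ σ) (_ ∷ Qs)       = selectedDegree σ Qs
    selectedDegree _           _              = 0

    Admissible : List Bool → List (ℕ × A) → Set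
    Admissible []          []             = ⊤
    Admissible []          (_ ∷ _)        = ⊥
    Admissible (_ ∷ _)     []             = ⊥
    Admissible (false ∷ σ) (_ ∷ Qs)       = Admissible σ Qs
    Admissible (true  ∷ σ) ((d , _) ∷ Qs) = 1 ≤ d × Admissible σ Qs

    none : List (ℕ × A) → List Bool
    none = map (λ _ → false)

    unselected-none : ∀ Qs → unselected (none Qs) Qs ≡ map proj₂ Qs
    unselected-none []       = refl
    unselected-none (Q ∷ Qs) = cong (proj₂ Q ∷_) (unselected-none Qs)

    admissible-none : ∀ Qs → Admissible (none Qs) Qs
    admissible-none []       = tt
    admissible-none (Q ∷ Qs) = admissible-none Qs

    #selected-none : ∀ Qs → #selected (none Qs) ≡ 0
    #selected-none []       = refl
    #selected-none (Q ∷ Qs) = #selected-none Qs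

    selectedDegree-none : ∀ Qs → selectedDegree (none Qs) Qs ≡ 0
    selectedDegree-none []       = refl
    selectedDegree-none (Q ∷ Qs) = selectedDegree-none Qs

    selections : List (ℕ × A) → ℕ → List (List Bool)
    selections []                 j       = [] ∷ []
    selections ((d     , _) ∷ Qs) zero    = map (false ∷_) (selections Qs zero)
    selections ((zero  , _) ∷ Qs) (suc j) = map (false ∷_) (selections Qs (suc j))
    selections ((suc d , _) ∷ Qs) (suc j) = map (false ∷_) (selections Qs (suc j)) ++ map (true ∷_) (selections Qs j)

    ∈-selections : ∀ Qs σ j → Admissible σ Qs → #selected σ ≤ j → σ ∈ selections Qs j
    ∈-selections []                 []          j       _         _           = here refl
    ∈-selections ((d     , _) ∷ Qs) (false ∷ σ) zero    adm       count       = ∈-map⁺ (false ∷_) (∈-selections Qs σ zero adm count)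
    ∈-selections ((zero  , _) ∷ Qs) (false ∷ σ) (suc j) adm       count       = ∈-map⁺ (false ∷_) (∈-selections Qs σ (suc j) adm count)
    ∈-selections ((suc d , _) ∷ Qs) (false ∷ σ) (suc j) adm       count       = ∈-++⁺ˡ (∈-map⁺ (false ∷_) (∈-selections Qs σ (suc j) adm count))
    ∈-selections ((suc d , _) ∷ Qs) (true  ∷ σ) (suc j) (_ , adm) (s≤s count) =
      ∈-++⁺ʳ (map (false ∷_) (selections Qs (suc j))) (∈-map⁺ (true ∷_) (∈-selections Qs σ j adm count))

    length-selections : ∀ Qs j → length (selections Qs j) ≤ binomial (sum (map proj₁ Qs) + j) j
    length-selections [] j = ℕₚ.≤-reflexive (≡.sym (binomial-diag j))
    length-selections ((d , _) ∷ Qs) zero = ℕₚ.≤-trans (ℕₚ.≤-reflexive (Listₚ.length-map _ (selections Qs zero))) (length-selections Qs zero)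
    length-selections ((zero , _) ∷ Qs) (suc j) =
      ℕₚ.≤-trans (ℕₚ.≤-reflexive (Listₚ.length-map _ (selections Qs (suc j)))) (length-selections Qs (suc j))
    length-selections ((suc d , _) ∷ Qs) (suc j) = begin
      length (map (false ∷_) (selections Qs (suc j)) ++ map (true ∷_) (selections Qs j))
        ≡⟨ Listₚ.length-++ (map (false ∷_) (selections Qs (suc j))) ⟩
      length (map (false ∷_) (selections Qs (suc j))) + length (map (true ∷_) (selections Qs j))
        ≡⟨ ≡.cong₂ _+_ (Listₚ.length-map _ (selections Qs (suc j))) (Listₚ.length-map _ (selections Qs j)) ⟩
      length (selections Qs (suc j)) + length (selections Qs j)
        ≤⟨ ℕₚ.+-mono-≤ (length-selections Qs (suc j)) (length-selections Qs j) ⟩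
      binomial (D + suc j) (suc j) + binomial (D + j) j
        ≤⟨ ℕₚ.+-monoʳ-≤ (binomial (D + suc j) (suc j)) (binomial-monoˡ-≤ j (ℕₚ.+-monoʳ-≤ D (ℕₚ.n≤1+n j))) ⟩
      binomial (D + suc j) (suc j) + binomial (D + suc j) j
        ≡⟨ ℕₚ.+-comm (binomial (D + suc j) (suc j)) (binomial (D + suc j) j) ⟩
      binomial (suc (D + suc j)) (suc j)
        ≤⟨ binomial-monoˡ-≤ (suc j) (s≤s (ℕₚ.+-monoˡ-≤ (suc j) (ℕₚ.m≤n+m D d))) ⟩
      binomial (suc d + D + suc j) (suc j) ∎
      where
      open ℕₚ.≤-Reasoning
      D = sum (map proj₁ Qs)

    selectedDegree-≤ : ∀ σ (Qs : List (ℕ × A)) → selectedDegree σ Qs ≤ sum (map proj₁ Qs)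
    selectedDegree-≤ []          _              = z≤n
    selectedDegree-≤ (true  ∷ _) []             = z≤n
    selectedDegree-≤ (false ∷ _) []             = z≤n
    selectedDegree-≤ (true  ∷ σ) ((d , _) ∷ Qs) = ℕₚ.+-monoʳ-≤ d (selectedDegree-≤ σ Qs)
    selectedDegree-≤ (false ∷ σ) ((d , _) ∷ Qs) = ℕₚ.≤-trans (selectedDegree-≤ σ Qs) (ℕₚ.m≤n+m _ d)

module FieldSums {a b} (F : Field a b) where
  open Field F hiding (zero)
  open import Algebra.Properties.CommutativeSemigroup +-commutativeSemigroup using (interchange)

  sumOver : ∀ {x} {X : Set x} → List X → (X → Carrier) → Carrier
  sumOver []       f = 0#
  sumOver (x ∷ xs) f = f x + sumOver xs f

  module _ {x} {X : Set x} where

    sumOver-cong : ∀ (xs : List X) {f g : X → Carrier} → (∀ y → f y ≈ g y) → sumOver xs f ≈ sumOver xs g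
    sumOver-cong []       e = refl
    sumOver-cong (y ∷ xs) e = +-cong (e y) (sumOver-cong xs e)

    sumOver-++ : ∀ (xs ys : List X) f → sumOver (xs ++ ys) f ≈ sumOver xs f + sumOver ys f
    sumOver-++ []       ys f = sym (+-identityˡ _)
    sumOver-++ (y ∷ xs) ys f = trans (+-congˡ (sumOver-++ xs ys f)) (sym (+-assoc _ _ _))

    sumOver-zero : ∀ (xs : List X) {f : X → Carrier} → (∀ y → f y ≈ 0#) → sumOver xs f ≈ 0#
    sumOver-zero []       e = refl
    sumOver-zero (y ∷ xs) e = trans (+-cong (e y) (sumOver-zero xs e)) (+-identityˡ _)

    sumOver-+ : ∀ (xs : List X) f g → sumOver xs (λ y → f y + g y) ≈ sumOver xs f + sumOver xs g
    sumOver-+ []       f g = sym (+-identityˡ _)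
    sumOver-+ (y ∷ xs) f g = trans (+-congˡ (sumOver-+ xs f g)) (interchange _ _ _ _)

    *-distribˡ-sumOver : ∀ (xs : List X) c f → c * sumOver xs f ≈ sumOver xs (λ y → c * f y)
    *-distribˡ-sumOver []       c f = zeroʳ c
    *-distribˡ-sumOver (y ∷ xs) c f = trans (distribˡ c _ _) (+-congˡ (*-distribˡ-sumOver xs c f))

  sumOver-map : ∀ {x y} {X : Set x} {Y : Set y} (h : X → Y) xs (f : Y → Carrier) →
                sumOver (map h xs) f ≡ sumOver xs (f ∘ h)
  sumOver-map h []       f = ≡.refl
  sumOver-map h (z ∷ xs) f = ≡.cong (f (h z) +_) (sumOver-map h xs f)

  sumOver-concatMap : ∀ {x y} {X : Set x} {Y : Set y} (h : X → List Y) xs (f : Y → Carrier) →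
                      sumOver (concatMap h xs) f ≈ sumOver xs (λ z → sumOver (h z) f)
  sumOver-concatMap h []       f = refl
  sumOver-concatMap h (z ∷ xs) f = trans (sumOver-++ (h z) (concatMap h xs) f) (+-congˡ (sumOver-concatMap h xs f))

  sumOver-comm : ∀ {x y} {X : Set x} {Y : Set y} xs ys (f : X → Y → Carrier) →
                 sumOver xs (λ u → sumOver ys (f u)) ≈ sumOver ys (λ v → sumOver xs (λ u → f u v))
  sumOver-comm []       ys f = sym (sumOver-zero ys (λ _ → refl))
  sumOver-comm (u ∷ xs) ys f =
    trans (+-congˡ (sumOver-comm xs ys f)) (sym (sumOver-+ ys (f u) (λ v → sumOver xs (λ w → f w v))))

  sumOver-filter : ∀ {x p} {X : Set x} {P : X → Set p} (P? : Decidable P) xs (f : X → Carrier) →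
                   (∀ t → ¬ P t → f t ≈ 0#) → sumOver (List.filter P? xs) f ≈ sumOver xs f
  sumOver-filter P? []       f _ = refl
  sumOver-filter P? (t ∷ ts) f dropped≈0 with P? t
  ... | yes _  = +-congˡ (sumOver-filter P? ts f dropped≈0)
  ... | no ¬Pt = trans (sumOver-filter P? ts f dropped≈0) (sym (trans (+-congʳ (dropped≈0 t ¬Pt)) (+-identityˡ _)))

  sumOver-All-zero : ∀ {x p} {X : Set x} {P : X → Set p} {xs} (f : X → Carrier) →
                     All P xs → (∀ t → P t → f t ≈ 0#) → sumOver xs f ≈ 0#
  sumOver-All-zero f []         _   = refl
  sumOver-All-zero f (pt ∷ pts) P⇒0 = trans (+-cong (P⇒0 _ pt) (sumOver-All-zero f pts P⇒0)) (+-identityˡ _)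

module RowReduction {a b} (F : Field a b) where
  open Field F hiding (zero)
  open import Algebra.Properties.Ring ring using (-‿distribˡ-*; -‿distribʳ-*)
  open import Algebra.Properties.Semiring.Sum semiring
    using (sum-syntax; sum-cong-≋; sum-replicate-zero; sum-remove; ∑-distrib-+; *-distribʳ-sum)
  open import Data.Vec.Functional using (insertAt)
  open import Data.Vec.Functional.Properties using (insertAt-lookup; insertAt-punchIn)
  open import Data.Fin using (punchIn)
  open import Relation.Binary.Reasoning.Setoid setoid

  ∑-zero : ∀ {n} (f : Fin n → Carrier) → (∀ i → f i ≈ 0#) → ∑[ i < n ] f i ≈ 0#
  ∑-zero {n} f f≈0 = trans (sum-cong-≋ f≈0) (sum-replicate-zero n)

  Independent : ∀ {p k} → (Fin p → Fin k → Carrier) → Set (a ⊔ b)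
  Independent {p} {k} v = (d : Fin p → Carrier) → (∀ i → ∑[ j < p ] (d j * v j i) ≈ 0#) → ∀ j → d j ≈ 0#

  Independent-dropColumn : ∀ {p k} (v : Fin p → Fin (suc k) → Carrier) →
                           Independent v → (∀ j → v j zero ≈ 0#) → Independent (λ j i → v j (suc i))
  Independent-dropColumn v indep v₀≈0 d dependent = indep d λ where
    zero    → ∑-zero _ (λ j → trans (*-congˡ (v₀≈0 j)) (zeroʳ (d j)))
    (suc i) → dependent i

  private
    neg-shift : ∀ s β r → - (s * β) * r ≈ s * - (β * r)
    neg-shift s β r = begin
      - (s * β) * r    ≈⟨ sym (-‿distribˡ-* (s * β) r) ⟩
      - (s * β * r)    ≈⟨ -‿cong (*-assoc s β r) ⟩
      - (s * (β * r))  ≈⟨ -‿distribʳ-* s (β * r) ⟩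
      s * - (β * r)    ∎

  -- One step of Gaussian elimination: clear the first column with the pivot row j (β is the inverse of the pivot),
  -- then delete row j and the first column.
  eliminate : ∀ {p k} → (Fin (suc p) → Fin (suc k) → Carrier) → Fin (suc p) → Carrier → Fin p → Fin k → Carrier
  eliminate v j β t i = v (punchIn j t) (suc i) + v (punchIn j t) zero * - (β * v j (suc i))

  Independent-eliminate : ∀ {p k} (v : Fin (suc p) → Fin (suc k) → Carrier) j β → v j zero * β ≈ 1# →
                          Independent v → Independent (eliminate v j β)
  Independent-eliminate {p} v j β pivot indep e dependent t = begin
    e t                ≡⟨ ≡.sym (insertAt-punchIn e j c t) ⟩
    d (punchIn j t)    ≈⟨ indep d dependent′ (punchIn j t) ⟩
    0#                 ∎
    where
    x : Fin p → Fin _ → Carrier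
    x t = v (punchIn j t)
    S₀ = ∑[ t < p ] (e t * x t zero)
    c = - (S₀ * β)
    d = insertAt e j c
    expand : ∀ i → ∑[ l < suc p ] (d l * v l i) ≈ c * v j i + ∑[ t < p ] (e t * x t i)
    expand i = trans (sum-remove {i = j} (λ l → d l * v l i))
      (+-cong (*-congʳ (reflexive (insertAt-lookup e j c)))
              (sum-cong-≋ λ t → *-congʳ (reflexive (insertAt-punchIn e j c t))))
    dependent′ : ∀ i → ∑[ l < suc p ] (d l * v l i) ≈ 0#
    dependent′ zero = begin
      ∑[ l < suc p ] (d l * v l zero)     ≈⟨ expand zero ⟩
      c * v j zero + S₀                   ≈⟨ +-congʳ (neg-shift S₀ β (v j zero)) ⟩
      S₀ * - (β * v j zero) + S₀          ≈⟨ +-congʳ (*-congˡ (-‿cong (trans (*-comm β (v j zero)) pivot))) ⟩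
      S₀ * - 1# + S₀                      ≈⟨ +-congʳ (sym (-‿distribʳ-* S₀ 1#)) ⟩
      - (S₀ * 1#) + S₀                    ≈⟨ +-congʳ (-‿cong (*-identityʳ S₀)) ⟩
      - S₀ + S₀                           ≈⟨ -‿inverseˡ S₀ ⟩
      0#                                  ∎
    dependent′ (suc i) = begin
      ∑[ l < suc p ] (d l * v l (suc i))                         ≈⟨ expand (suc i) ⟩
      c * v j (suc i) + ∑[ t < p ] (e t * x t (suc i))           ≈⟨ +-comm _ _ ⟩
      ∑[ t < p ] (e t * x t (suc i)) + c * v j (suc i)           ≈⟨ +-congˡ (neg-shift S₀ β (v j (suc i))) ⟩
      ∑[ t < p ] (e t * x t (suc i)) + S₀ * γ                    ≈⟨ +-congˡ (*-distribʳ-sum γ (λ t → e t * x t zero)) ⟩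
      ∑[ t < p ] (e t * x t (suc i)) + ∑[ t < p ] (e t * x t zero * γ)
                                                                 ≈⟨ sym (∑-distrib-+ (λ t → e t * x t (suc i)) (λ t → e t * x t zero * γ)) ⟩
      ∑[ t < p ] (e t * x t (suc i) + e t * x t zero * γ)        ≈⟨ sum-cong-≋ (λ t → sym (distrib-shift t)) ⟩
      ∑[ t < p ] (e t * eliminate v j β t i)                     ≈⟨ dependent i ⟩
      0#                                                         ∎
      where
      γ = - (β * v j (suc i))
      distrib-shift : ∀ t → e t * (x t (suc i) + x t zero * γ) ≈ e t * x t (suc i) + e t * x t zero * γ
      distrib-shift t = trans (distribˡ (e t) _ _) (+-congˡ (sym (*-assoc (e t) _ γ)))

  Independent⇒≤ : ∀ {p k} (v : Fin p → Fin k → Carrier) → Independent v → ¬ ¬ (p ≤ k)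
  Independent⇒≤ {zero}  {k}     v indep = ¬¬-intro z≤n
  Independent⇒≤ {suc p} {zero}  v indep = λ _ → 0≉1 (sym (indep (λ _ → 1#) (λ ()) zero))
  Independent⇒≤ {suc p} {suc k} v indep = ¬¬-∀⊎∃¬ (λ j → v j zero ≈ 0#) ¬¬>>= λ where
    (inj₁ v₀≈0) →
      ¬¬-map ℕₚ.m≤n⇒m≤1+n (Independent⇒≤ (λ j i → v j (suc i)) (Independent-dropColumn v indep v₀≈0))
    (inj₂ (j , v₀≉0)) → let (β , pivot) = inverse (v j zero) v₀≉0 in
      ¬¬-map s≤s (Independent⇒≤ (eliminate v j β) (Independent-eliminate v j β pivot indep))

module PolynomialCalculus {a b} (F : Field a b) (N : ℕ) where
  open Field F hiding (zero)
  open FieldSums F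
  open Poly F N public
  open import Relation.Binary.Reasoning.Setoid setoid
  open import Algebra.Properties.CommutativeSemigroup *-commutativeSemigroup using (x∙yz≈y∙xz)

  Term : Set a
  Term = Monomial × Carrier

  termMul : Term → Term → Term
  termMul (β , c) (β′ , c′) = β ⊕ β′ , c * c′

  termCoeff : Term → Monomial → Carrier
  termCoeff (β , c) α with Vecₚ.≡-dec Nat._≟_ β α
  ... | yes _ = c
  ... | no  _ = 0#

  termCoeff-≡ : ∀ β c {α} → β ≡ α → termCoeff (β , c) α ≡ c
  termCoeff-≡ β c {α} β≡α with Vecₚ.≡-dec Nat._≟_ β α
  ... | yes _  = ≡.refl
  ... | no β≢α = ⊥-elim (β≢α β≡α)

  termCoeff-≢ : ∀ β c {α} → β ≢ α → termCoeff (β , c) α ≡ 0#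
  termCoeff-≢ β c {α} β≢α with Vecₚ.≡-dec Nat._≟_ β α
  ... | yes β≡α = ⊥-elim (β≢α β≡α)
  ... | no _    = ≡.refl

  termCoeff-cong : ∀ {β β′ c c′} α → β ≡ β′ → c ≈ c′ → termCoeff (β , c) α ≈ termCoeff (β′ , c′) α
  termCoeff-cong {β} α ≡.refl c≈c′ with Vecₚ.≡-dec Nat._≟_ β α
  ... | yes _ = c≈c′
  ... | no  _ = refl

  termCoeff-zero : ∀ β {c} α → c ≈ 0# → termCoeff (β , c) α ≈ 0#
  termCoeff-zero β α c≈0 with Vecₚ.≡-dec Nat._≟_ β α
  ... | yes _ = c≈0
  ... | no  _ = refl

  termCoeff-* : ∀ β c d α → termCoeff (β , c * d) α ≈ c * termCoeff (β , d) α
  termCoeff-* β c d α with Vecₚ.≡-dec Nat._≟_ β α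
  ... | yes _ = refl
  ... | no  _ = sym (zeroʳ c)

  termCoeff-+ : ∀ β c d α → termCoeff (β , c + d) α ≈ termCoeff (β , c) α + termCoeff (β , d) α
  termCoeff-+ β c d α with Vecₚ.≡-dec Nat._≟_ β α
  ... | yes _ = refl
  ... | no  _ = sym (+-identityˡ _)

  coeff-sumOver : ∀ p α → coeff p α ≈ sumOver p (λ t → termCoeff t α)
  coeff-sumOver []            α = refl
  coeff-sumOver ((β , c) ∷ p) α with Vecₚ.≡-dec Nat._≟_ β α
  ... | yes _ = +-congˡ (coeff-sumOver p α)
  ... | no  _ = trans (coeff-sumOver p α) (sym (+-identityˡ _))

  coeff-+P : ∀ p q α → coeff (p +P q) α ≈ coeff p α + coeff q α
  coeff-+P p q α = begin
    coeff (p ++ q) α                                                         ≈⟨ coeff-sumOver (p ++ q) α ⟩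
    sumOver (p ++ q) (λ t → termCoeff t α)                                   ≈⟨ sumOver-++ p q _ ⟩
    sumOver p (λ t → termCoeff t α) + sumOver q (λ t → termCoeff t α)        ≈⟨ +-cong (coeff-sumOver p α) (coeff-sumOver q α) ⟨
    coeff p α + coeff q α                                                    ∎

  coeff-scale : ∀ c p α → coeff (scale c p) α ≈ c * coeff p α
  coeff-scale c p α = begin
    coeff (scale c p) α                                        ≈⟨ coeff-sumOver (scale c p) α ⟩
    sumOver (scale c p) (λ t → termCoeff t α)                  ≡⟨ sumOver-map _ p _ ⟩
    sumOver p (λ t → termCoeff (proj₁ t , c * proj₂ t) α)      ≈⟨ sumOver-cong p (λ t → termCoeff-* (proj₁ t) c (proj₂ t) α) ⟩
    sumOver p (λ t → c * termCoeff t α)                        ≈⟨ *-distribˡ-sumOver p c _ ⟨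
    c * sumOver p (λ t → termCoeff t α)                        ≈⟨ *-congˡ (coeff-sumOver p α) ⟨
    c * coeff p α                                              ∎

  coeff-*P : ∀ p q α → coeff (p *P q) α ≈ sumOver p (λ t → sumOver q (λ u → termCoeff (termMul t u) α))
  coeff-*P p q α = begin
    coeff (p *P q) α                                                           ≈⟨ coeff-sumOver (p *P q) α ⟩
    sumOver (p *P q) (λ t → termCoeff t α)                                     ≈⟨ sumOver-concatMap _ p _ ⟩
    sumOver p (λ t → sumOver (map (termMul t) q) (λ t → termCoeff t α))        ≈⟨ sumOver-cong p (λ t → reflexive (sumOver-map (termMul t) q _)) ⟩
    sumOver p (λ t → sumOver q (λ u → termCoeff (termMul t u) α))              ∎

  coeff-lincomb : ∀ L α → coeff (lincomb L) α ≈ sumOver L (λ t → proj₁ t * coeff (proj₂ t) α)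
  coeff-lincomb []            α = refl
  coeff-lincomb ((c , v) ∷ L) α =
    trans (coeff-+P (scale c v) (lincomb L) α) (+-cong (coeff-scale c v α) (coeff-lincomb L α))

  ≋-trans : ∀ p q r → p ≋ q → q ≋ r → p ≋ r
  ≋-trans p q r p≋q q≋r α = trans (p≋q α) (q≋r α)

  +P-cong : ∀ p p′ q q′ → p ≋ p′ → q ≋ q′ → (p +P q) ≋ (p′ +P q′)
  +P-cong p p′ q q′ p≋p′ q≋q′ α =
    trans (coeff-+P p q α) (trans (+-cong (p≋p′ α) (q≋q′ α)) (sym (coeff-+P p′ q′ α)))

  -- Multiplying by one term shifts exponents by γ: only the coefficient of α ∸ γ in q contributes.
  sumOver-termMul-cong : ∀ t q q′ α → q ≋ q′ →
    sumOver q (λ u → termCoeff (termMul t u) α) ≈ sumOver q′ (λ u → termCoeff (termMul t u) α)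
  sumOver-termMul-cong (γ , d) q q′ α q≋q′ = by-cases (Vecₚ.≡-dec Nat._≟_ (γ ⊕ δ) α)
    where
    δ = Vec.zipWith Nat._∸_ α γ
    Σ[_] : Polynomial → Carrier
    Σ[ q ] = sumOver q (λ u → termCoeff (termMul (γ , d) u) α)
    by-cases : Dec (γ ⊕ δ ≡ α) → Σ[ q ] ≈ Σ[ q′ ]
    by-cases (yes γ⊕δ≡α) = trans (collapse q) (trans (*-congˡ (q≋q′ δ)) (sym (collapse q′)))
      where
      termwise : ∀ β c → Dec (β ≡ δ) → termCoeff (γ ⊕ β , d * c) α ≈ d * termCoeff (β , c) δ
      termwise β c (yes ≡.refl) = trans (reflexive (termCoeff-≡ _ _ γ⊕δ≡α)) (*-congˡ (reflexive (≡.sym (termCoeff-≡ β c ≡.refl))))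
      termwise β c (no β≢δ)     = trans (reflexive (termCoeff-≢ _ _ (λ γ⊕β≡α → β≢δ (≡.sym (⊕-∸ γ β α γ⊕β≡α)))))
                                        (trans (sym (zeroʳ d)) (*-congˡ (reflexive (≡.sym (termCoeff-≢ β c β≢δ)))))
      collapse : ∀ q → Σ[ q ] ≈ d * coeff q δ
      collapse q = trans (sumOver-cong q (λ (β , c) → termwise β c (Vecₚ.≡-dec Nat._≟_ β δ)))
                         (trans (sym (*-distribˡ-sumOver q d _)) (*-congˡ (sym (coeff-sumOver q δ))))
    by-cases (no γ⊕δ≢α) = trans (sumOver-zero q vanish) (sym (sumOver-zero q′ vanish))
      where
      vanish : ∀ u → termCoeff (termMul (γ , d) u) α ≈ 0#
      vanish (β , c) = reflexive (termCoeff-≢ _ _ λ γ⊕β≡α →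
        γ⊕δ≢α (≡.subst (λ w → γ ⊕ w ≡ α) (≡.sym (⊕-∸ γ β α γ⊕β≡α)) γ⊕β≡α))

  *P-comm : ∀ p q → (p *P q) ≋ (q *P p)
  *P-comm p q α = begin
    coeff (p *P q) α                                                   ≈⟨ coeff-*P p q α ⟩
    sumOver p (λ t → sumOver q (λ u → termCoeff (termMul t u) α))      ≈⟨ sumOver-comm p q _ ⟩
    sumOver q (λ u → sumOver p (λ t → termCoeff (termMul t u) α))      ≈⟨ sumOver-cong q (λ u → sumOver-cong p (λ t →
                                                                            termCoeff-cong α (⊕-comm (proj₁ t) (proj₁ u)) (*-comm _ _))) ⟩
    sumOver q (λ u → sumOver p (λ t → termCoeff (termMul u t) α))      ≈⟨ coeff-*P q p α ⟨
    coeff (q *P p) α                                                   ∎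

  *P-congʳ : ∀ p q q′ → q ≋ q′ → (p *P q) ≋ (p *P q′)
  *P-congʳ p q q′ q≋q′ α = trans (coeff-*P p q α)
    (trans (sumOver-cong p (λ t → sumOver-termMul-cong t q q′ α q≋q′)) (sym (coeff-*P p q′ α)))

  *P-congˡ : ∀ p p′ q → p ≋ p′ → (p *P q) ≋ (p′ *P q)
  *P-congˡ p p′ q p≋p′ α = begin
    coeff (p *P q) α   ≈⟨ *P-comm p q α ⟩
    coeff (q *P p) α   ≈⟨ *P-congʳ q p p′ p≋p′ α ⟩
    coeff (q *P p′) α  ≈⟨ *P-comm q p′ α ⟩
    coeff (p′ *P q) α  ∎

  *P-cong : ∀ p p′ q q′ → p ≋ p′ → q ≋ q′ → (p *P q) ≋ (p′ *P q′)
  *P-cong p p′ q q′ p≋p′ q≋q′ α = trans (*P-congʳ p q q′ q≋q′ α) (*P-congˡ p p′ q′ p≋p′ α)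

  fromℕ : ℕ → Carrier
  fromℕ k = natMul k 1#

  natMul≈fromℕ* : ∀ k x → natMul k x ≈ fromℕ k * x
  natMul≈fromℕ* zero    x = sym (zeroˡ x)
  natMul≈fromℕ* (suc k) x = trans (+-cong (sym (*-identityˡ x)) (natMul≈fromℕ* k x)) (sym (distribʳ x 1# (fromℕ k)))

  fromℕ-+ : ∀ k l → fromℕ (k Nat.+ l) ≈ fromℕ k + fromℕ l
  fromℕ-+ zero    l = sym (+-identityˡ _)
  fromℕ-+ (suc k) l = trans (+-congˡ (fromℕ-+ k l)) (sym (+-assoc _ _ _))

  ∂ₜ : Fin N → Term → Term
  ∂ₜ i (β , c) = lower β i , natMul (Vec.lookup β i) c

  termCoeff-∂ₜ : ∀ i β c α → termCoeff (∂ₜ i (β , c)) α ≈ fromℕ (suc (Vec.lookup α i)) * termCoeff (β , c) (raise α i)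
  termCoeff-∂ₜ i β c α with Vec.lookup β i in βᵢ≡
  ... | zero = trans (termCoeff-zero (lower β i) α refl)
                     (trans (sym (zeroʳ _)) (*-congˡ (reflexive (≡.sym (termCoeff-≢ β c β≢raise)))))
    where
    β≢raise : β ≢ raise α i
    β≢raise β≡raise with ≡.trans (≡.sym βᵢ≡) (≡.trans (≡.cong (λ v → Vec.lookup v i) β≡raise) (Vecₚ.lookup∘updateAt i α))
    ... | ()
  ... | suc k = by-cases (Vecₚ.≡-dec Nat._≟_ (lower β i) α)
    where
    by-cases : Dec (lower β i ≡ α) → termCoeff (lower β i , natMul (suc k) c) α ≈ fromℕ (suc (Vec.lookup α i)) * termCoeff (β , c) (raise α i)
    by-cases (yes lower≡α) = trans (reflexive (termCoeff-≡ _ _ lower≡α))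
      (trans (natMul≈fromℕ* (suc k) c) (*-cong (reflexive (≡.cong fromℕ (≡.cong suc k≡αᵢ))) (reflexive (≡.sym (termCoeff-≡ β c β≡raise)))))
      where
      k≡αᵢ : k ≡ Vec.lookup α i
      k≡αᵢ = ≡.trans (≡.cong pred (≡.sym βᵢ≡)) (≡.trans (≡.sym (Vecₚ.lookup∘updateAt i β)) (≡.cong (λ v → Vec.lookup v i) lower≡α))
      β≡raise : β ≡ raise α i
      β≡raise = ≡.trans (≡.sym (raise-lower β i βᵢ≡)) (≡.cong (λ v → raise v i) lower≡α)
    by-cases (no lower≢α) = trans (reflexive (termCoeff-≢ _ _ lower≢α))
      (trans (sym (zeroʳ _)) (*-congˡ (reflexive (≡.sym (termCoeff-≢ β c λ β≡raise →
        lower≢α (≡.trans (≡.cong (λ v → lower v i) β≡raise) (lower-raise α i)))))))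

  coeff-∂ : ∀ i p α → coeff (∂ i p) α ≈ fromℕ (suc (Vec.lookup α i)) * coeff p (raise α i)
  coeff-∂ i p α = begin
    coeff (∂ i p) α                                                                  ≈⟨ coeff-sumOver (∂ i p) α ⟩
    sumOver (∂ i p) (λ t → termCoeff t α)                                            ≡⟨ sumOver-map (∂ₜ i) p _ ⟩
    sumOver p (λ t → termCoeff (∂ₜ i t) α)                                           ≈⟨ sumOver-cong p (λ (β , c) → termCoeff-∂ₜ i β c α) ⟩
    sumOver p (λ t → fromℕ (suc (Vec.lookup α i)) * termCoeff t (raise α i))         ≈⟨ *-distribˡ-sumOver p _ _ ⟨
    fromℕ (suc (Vec.lookup α i)) * sumOver p (λ t → termCoeff t (raise α i))         ≈⟨ *-congˡ (coeff-sumOver p (raise α i)) ⟨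
    fromℕ (suc (Vec.lookup α i)) * coeff p (raise α i)                               ∎

  record IsLinear (Φ : Polynomial → Polynomial) : Set (a ⊔ b) where
    field
      cong       : ∀ p q → p ≋ q → Φ p ≋ Φ q
      +P-homo    : ∀ p q → Φ (p +P q) ≋ (Φ p +P Φ q)
      scale-homo : ∀ c p → Φ (scale c p) ≋ scale c (Φ p)
      0P-homo    : Φ 0P ≋ 0P

  lincomb-homo : ∀ {Φ} → IsLinear Φ → ∀ L → Φ (lincomb L) ≋ lincomb (map (λ (c , v) → c , Φ v) L)
  lincomb-homo lin []            = IsLinear.0P-homo lin
  lincomb-homo {Φ} lin ((c , v) ∷ L) α = begin
    coeff (Φ (scale c v +P lincomb L)) α                            ≈⟨ IsLinear.+P-homo lin (scale c v) (lincomb L) α ⟩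
    coeff (Φ (scale c v) +P Φ (lincomb L)) α                        ≈⟨ +P-cong (Φ (scale c v)) (scale c (Φ v)) (Φ (lincomb L)) (lincomb L′)
                                                                          (IsLinear.scale-homo lin c v) (lincomb-homo lin L) α ⟩
    coeff (scale c (Φ v) +P lincomb L′) α                           ∎
    where L′ = map (λ (c , v) → c , Φ v) L

  ∂-isLinear : ∀ i → IsLinear (∂ i)
  ∂-isLinear i = record
    { cong       = λ p q p≋q α → trans (coeff-∂ i p α) (trans (*-congˡ (p≋q _)) (sym (coeff-∂ i q α)))
    ; +P-homo    = λ p q α → reflexive (≡.cong (λ r → coeff r α) (Listₚ.map-++ (∂ₜ i) p q))
    ; scale-homo = λ c p α → begin
        coeff (∂ i (scale c p)) α                                 ≈⟨ coeff-∂ i (scale c p) α ⟩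
        fromℕ (suc (Vec.lookup α i)) * coeff (scale c p) (raise α i) ≈⟨ *-congˡ (coeff-scale c p _) ⟩
        fromℕ (suc (Vec.lookup α i)) * (c * coeff p (raise α i))   ≈⟨ x∙yz≈y∙xz _ c _ ⟩
        c * (fromℕ (suc (Vec.lookup α i)) * coeff p (raise α i))   ≈⟨ *-congˡ (coeff-∂ i p α) ⟨
        c * coeff (∂ i p) α                                        ≈⟨ coeff-scale c (∂ i p) α ⟨
        coeff (scale c (∂ i p)) α                                  ∎
    ; 0P-homo    = λ α → refl
    }

  *P-isLinearʳ : ∀ q → IsLinear (q *P_)
  *P-isLinearʳ q = record
    { cong       = *P-congʳ q
    ; +P-homo    = λ p p′ α → begin
        coeff (q *P (p +P p′)) α                                      ≈⟨ coeff-*P q (p +P p′) α ⟩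
        sumOver q (λ t → Σ[ t , p ++ p′ ] α)                          ≈⟨ sumOver-cong q (λ t → sumOver-++ p p′ _) ⟩
        sumOver q (λ t → Σ[ t , p ] α + Σ[ t , p′ ] α)                ≈⟨ sumOver-+ q _ _ ⟩
        sumOver q (λ t → Σ[ t , p ] α) + sumOver q (λ t → Σ[ t , p′ ] α)
                                                                      ≈⟨ +-cong (coeff-*P q p α) (coeff-*P q p′ α) ⟨
        coeff (q *P p) α + coeff (q *P p′) α                          ≈⟨ coeff-+P (q *P p) (q *P p′) α ⟨
        coeff ((q *P p) +P (q *P p′)) α                               ∎
    ; scale-homo = λ c p α → begin
        coeff (q *P scale c p) α                                      ≈⟨ coeff-*P q (scale c p) α ⟩
        sumOver q (λ t → Σ[ t , scale c p ] α)                        ≈⟨ sumOver-cong q (λ t → pull-out c p t α) ⟩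
        sumOver q (λ t → c * Σ[ t , p ] α)                            ≈⟨ *-distribˡ-sumOver q c _ ⟨
        c * sumOver q (λ t → Σ[ t , p ] α)                            ≈⟨ *-congˡ (coeff-*P q p α) ⟨
        c * coeff (q *P p) α                                          ≈⟨ coeff-scale c (q *P p) α ⟨
        coeff (scale c (q *P p)) α                                    ∎
    ; 0P-homo    = λ α → trans (coeff-*P q [] α) (sumOver-zero q (λ _ → refl))
    }
    where
    Σ[_,_] : Term → Polynomial → Monomial → Carrier
    Σ[ t , p ] α = sumOver p (λ u → termCoeff (termMul t u) α)
    pull-out : ∀ c p t α → Σ[ t , scale c p ] α ≈ c * Σ[ t , p ] α
    pull-out c p (γ , d) α = begin
      Σ[ (γ , d) , scale c p ] α                                      ≡⟨ sumOver-map _ p _ ⟩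
      sumOver p (λ (β , e) → termCoeff (γ ⊕ β , d * (c * e)) α)       ≈⟨ sumOver-cong p (λ (β , e) →
                                                                            trans (termCoeff-cong {γ ⊕ β} α ≡.refl (x∙yz≈y∙xz d c e))
                                                                                  (termCoeff-* (γ ⊕ β) c (d * e) α)) ⟩
      sumOver p (λ u → c * termCoeff (termMul (γ , d) u) α)           ≈⟨ *-distribˡ-sumOver p c _ ⟨
      c * Σ[ (γ , d) , p ] α                                          ∎

  termCoeff-exponent : ∀ {β β′} c α → β ≡ β′ ⊎ c ≈ 0# → termCoeff (β , c) α ≈ termCoeff (β′ , c) α
  termCoeff-exponent c α (inj₁ ≡.refl)       = refl
  termCoeff-exponent {β} {β′} c α (inj₂ c≈0) = trans (termCoeff-zero β α c≈0) (sym (termCoeff-zero β′ α c≈0))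

  natMul-leibniz : ∀ k l c c′ → natMul (k Nat.+ l) (c * c′) ≈ natMul k c * c′ + c * natMul l c′
  natMul-leibniz k l c c′ = begin
    natMul (k Nat.+ l) (c * c′)              ≈⟨ natMul≈fromℕ* (k Nat.+ l) _ ⟩
    fromℕ (k Nat.+ l) * (c * c′)             ≈⟨ *-congʳ (fromℕ-+ k l) ⟩
    (fromℕ k + fromℕ l) * (c * c′)           ≈⟨ distribʳ _ _ _ ⟩
    fromℕ k * (c * c′) + fromℕ l * (c * c′)  ≈⟨ +-cong (sym (*-assoc _ _ _)) (x∙yz≈y∙xz _ c c′) ⟩
    fromℕ k * c * c′ + c * (fromℕ l * c′)    ≈⟨ +-cong (*-congʳ (natMul≈fromℕ* k c)) (*-congˡ (natMul≈fromℕ* l c′)) ⟨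
    natMul k c * c′ + c * natMul l c′        ∎

  termCoeff-∂ₜ-termMul : ∀ i t u α →
    termCoeff (∂ₜ i (termMul t u)) α ≈ termCoeff (termMul (∂ₜ i t) u) α + termCoeff (termMul t (∂ₜ i u)) α
  termCoeff-∂ₜ-termMul i (β , c) (β′ , c′) α = begin
    termCoeff (lower (β ⊕ β′) i , natMul (Vec.lookup (β ⊕ β′) i) (c * c′)) α
      ≈⟨ termCoeff-cong {lower (β ⊕ β′) i} α ≡.refl (trans (reflexive (≡.cong (λ k → natMul k (c * c′)) (Vecₚ.lookup-zipWith Nat._+_ i β β′)))
                                        (natMul-leibniz (Vec.lookup β i) (Vec.lookup β′ i) c c′)) ⟩
    termCoeff (lower (β ⊕ β′) i , natMul (Vec.lookup β i) c * c′ + c * natMul (Vec.lookup β′ i) c′) α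
      ≈⟨ termCoeff-+ (lower (β ⊕ β′) i) _ _ α ⟩
    termCoeff (lower (β ⊕ β′) i , natMul (Vec.lookup β i) c * c′) α + termCoeff (lower (β ⊕ β′) i , c * natMul (Vec.lookup β′ i) c′) α
      ≈⟨ +-cong (termCoeff-exponent _ α (Sum.map₂ left-vanishes (lower-⊕ˡ-or-zero β β′ i)))
                (termCoeff-exponent _ α (Sum.map₂ right-vanishes (lower-⊕ʳ-or-zero β β′ i))) ⟩
    termCoeff (lower β i ⊕ β′ , natMul (Vec.lookup β i) c * c′) α + termCoeff (β ⊕ lower β′ i , c * natMul (Vec.lookup β′ i) c′) α ∎
    where
    left-vanishes : Vec.lookup β i ≡ 0 → natMul (Vec.lookup β i) c * c′ ≈ 0#
    left-vanishes βᵢ≡0 = trans (*-congʳ (reflexive (≡.cong (λ k → natMul k c) βᵢ≡0))) (zeroˡ c′)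
    right-vanishes : Vec.lookup β′ i ≡ 0 → c * natMul (Vec.lookup β′ i) c′ ≈ 0#
    right-vanishes β′ᵢ≡0 = trans (*-congˡ (reflexive (≡.cong (λ k → natMul k c′) β′ᵢ≡0))) (zeroʳ c)

  ∂-*P : ∀ i p q → ∂ i (p *P q) ≋ ((∂ i p *P q) +P (p *P ∂ i q))
  ∂-*P i p q α = begin
    coeff (∂ i (p *P q)) α                                              ≈⟨ coeff-sumOver (∂ i (p *P q)) α ⟩
    sumOver (∂ i (p *P q)) (λ t → termCoeff t α)                        ≡⟨ sumOver-map (∂ₜ i) (p *P q) _ ⟩
    sumOver (p *P q) (λ w → termCoeff (∂ₜ i w) α)                       ≈⟨ sumOver-concatMap _ p _ ⟩
    sumOver p (λ t → sumOver (map (termMul t) q) (λ w → termCoeff (∂ₜ i w) α))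
                                                                        ≈⟨ sumOver-cong p (λ t → reflexive (sumOver-map (termMul t) q _)) ⟩
    sumOver p (λ t → sumOver q (λ u → termCoeff (∂ₜ i (termMul t u)) α))
                                                                        ≈⟨ sumOver-cong p (λ t → sumOver-cong q (λ u → termCoeff-∂ₜ-termMul i t u α)) ⟩
    sumOver p (λ t → sumOver q (λ u → L t u + R t u))                   ≈⟨ sumOver-cong p (λ t → sumOver-+ q (L t) (R t)) ⟩
    sumOver p (λ t → sumOver q (L t) + sumOver q (R t))                 ≈⟨ sumOver-+ p _ _ ⟩
    sumOver p (λ t → sumOver q (L t)) + sumOver p (λ t → sumOver q (R t))
                                                                        ≈⟨ +-cong left right ⟩
    coeff (∂ i p *P q) α + coeff (p *P ∂ i q) α                         ≈⟨ coeff-+P (∂ i p *P q) (p *P ∂ i q) α ⟨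
    coeff ((∂ i p *P q) +P (p *P ∂ i q)) α                              ∎
    where
    L R : Term → Term → Carrier
    L t u = termCoeff (termMul (∂ₜ i t) u) α
    R t u = termCoeff (termMul t (∂ₜ i u)) α
    left : sumOver p (λ t → sumOver q (L t)) ≈ coeff (∂ i p *P q) α
    left = sym (trans (coeff-*P (∂ i p) q α) (reflexive (sumOver-map (∂ₜ i) p _)))
    right : sumOver p (λ t → sumOver q (R t)) ≈ coeff (p *P ∂ i q) α
    right = sym (trans (coeff-*P p (∂ i q) α) (sumOver-cong p (λ t → reflexive (sumOver-map (∂ₜ i) q _))))

  coeff-mono*P : ∀ γ q α → coeff (mono γ *P q) α ≈ sumOver q (λ (β , c) → termCoeff (γ ⊕ β , c) α)
  coeff-mono*P γ q α = trans (coeff-*P (mono γ) q α)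
    (trans (+-identityʳ _) (sumOver-cong q (λ (β , c) → termCoeff-cong {γ ⊕ β} α ≡.refl (*-identityˡ c))))

  mono-identity : ∀ q → (mono (Vec.replicate N 0) *P q) ≋ q
  mono-identity q α = trans (coeff-mono*P _ q α)
    (trans (sumOver-cong q (λ (β , c) → termCoeff-cong α (⊕-identityˡ β) refl)) (sym (coeff-sumOver q α)))

  sumOver-mono*P : ∀ β q f → sumOver (mono β *P q) f ≡ sumOver q (λ u → f (termMul (β , 1#) u))
  sumOver-mono*P β q f = ≡.trans (≡.cong (λ r → sumOver r f) (Listₚ.++-identityʳ (map (termMul (β , 1#)) q)))
                                 (sumOver-map (termMul (β , 1#)) q f)

  mono-*P-mono : ∀ μ β q → (mono μ *P (mono β *P q)) ≋ (mono (μ ⊕ β) *P q)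
  mono-*P-mono μ β q α = begin
    coeff (mono μ *P (mono β *P q)) α                               ≈⟨ coeff-mono*P μ (mono β *P q) α ⟩
    sumOver (mono β *P q) (λ (β′ , c) → termCoeff (μ ⊕ β′ , c) α)   ≡⟨ sumOver-mono*P β q _ ⟩
    sumOver q (λ (β′ , c) → termCoeff (μ ⊕ (β ⊕ β′) , 1# * c) α)    ≈⟨ sumOver-cong q (λ (β′ , c) →
                                                                          termCoeff-cong α (≡.sym (⊕-assoc μ β β′)) (*-identityˡ c)) ⟩
    sumOver q (λ (β′ , c) → termCoeff ((μ ⊕ β) ⊕ β′ , c) α)         ≈⟨ coeff-mono*P (μ ⊕ β) q α ⟨
    coeff (mono (μ ⊕ β) *P q) α                                     ∎

  *P-mono-comm : ∀ p β q → (p *P (mono β *P q)) ≋ (mono β *P (p *P q))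
  *P-mono-comm p β q α = begin
    coeff (p *P (mono β *P q)) α                                                 ≈⟨ coeff-*P p (mono β *P q) α ⟩
    sumOver p (λ t → sumOver (mono β *P q) (λ u → termCoeff (termMul t u) α))   ≈⟨ sumOver-cong p (λ t → reflexive (sumOver-mono*P β q _)) ⟩
    sumOver p (λ t → sumOver q (λ u → termCoeff (termMul t (termMul (β , 1#) u)) α))
                                                                                 ≈⟨ sumOver-cong p (λ (γ , d) → sumOver-cong q (λ (β′ , c) →
                                                                                      termCoeff-cong α (swap-middle γ β′)
                                                                                        (trans (*-congˡ (*-identityˡ c)) (sym (*-identityˡ (d * c)))))) ⟩
    sumOver p (λ t → sumOver q (λ u → termCoeff (termMul (β , 1#) (termMul t u)) α))
                                                                                 ≈⟨ sumOver-cong p (λ t → reflexive (sumOver-map (termMul t) q _)) ⟨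
    sumOver p (λ t → sumOver (map (termMul t) q) (λ w → termCoeff (termMul (β , 1#) w) α))
                                                                                 ≈⟨ sumOver-concatMap _ p _ ⟨
    sumOver (p *P q) (λ w → termCoeff (termMul (β , 1#) w) α)                    ≡⟨ sumOver-mono*P β (p *P q) _ ⟨
    sumOver (mono β *P (p *P q)) (λ w → termCoeff w α)                           ≈⟨ coeff-sumOver (mono β *P (p *P q)) α ⟨
    coeff (mono β *P (p *P q)) α                                                 ∎
    where
    swap-middle : ∀ γ β′ → γ ⊕ (β ⊕ β′) ≡ β ⊕ (γ ⊕ β′)
    swap-middle γ β′ = ≡.trans (≡.sym (⊕-assoc γ β β′)) (≡.trans (≡.cong (_⊕ β′) (⊕-comm γ β)) (⊕-assoc β γ β′))

  singleton-*P : ∀ β c q → (((β , c) ∷ []) *P q) ≋ scale c (mono β *P q)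
  singleton-*P β c q α = begin
    coeff (((β , c) ∷ []) *P q) α                                     ≈⟨ coeff-*P ((β , c) ∷ []) q α ⟩
    sumOver q (λ (β′ , c′) → termCoeff (β ⊕ β′ , c * c′) α) + 0#     ≈⟨ +-identityʳ _ ⟩
    sumOver q (λ (β′ , c′) → termCoeff (β ⊕ β′ , c * c′) α)          ≈⟨ sumOver-cong q (λ (β′ , c′) → termCoeff-* (β ⊕ β′) c c′ α) ⟩
    sumOver q (λ (β′ , c′) → c * termCoeff (β ⊕ β′ , c′) α)          ≈⟨ *-distribˡ-sumOver q c _ ⟨
    c * sumOver q (λ (β′ , c′) → termCoeff (β ⊕ β′ , c′) α)          ≈⟨ *-congˡ (coeff-mono*P β q α) ⟨
    c * coeff (mono β *P q) α                                         ≈⟨ coeff-scale c (mono β *P q) α ⟨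
    coeff (scale c (mono β *P q)) α                                   ∎

  scale-zero : ∀ {c} q → c ≈ 0# → scale c q ≋ 0P
  scale-zero {c} q c≈0 α = trans (coeff-scale c q α) (trans (*-congʳ c≈0) (zeroˡ _))

  ∷-*P : ∀ t ts q → ((t ∷ ts) *P q) ≋ (((t ∷ []) *P q) +P (ts *P q))
  ∷-*P t ts q α = reflexive (≡.cong (λ r → coeff (r ++ (ts *P q)) α) (≡.sym (Listₚ.++-identityʳ (map (termMul t) q))))

  ∂*-cong : ∀ {j} (is : Vec (Fin N) j) p q → p ≋ q → ∂* is p ≋ ∂* is q
  ∂*-cong Vec.[]       p q p≋q = p≋q
  ∂*-cong (i Vec.∷ is) p q p≋q = IsLinear.cong (∂-isLinear i) (∂* is p) (∂* is q) (∂*-cong is p q p≋q)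

module Spans {a b} (F : Field a b) (N : ℕ) where
  open Field F hiding (zero)
  open FieldSums F
  open PolynomialCalculus F N
  open import Relation.Binary.Reasoning.Setoid setoid

  Span : ∀ {ℓ} → (Polynomial → Set ℓ) → Polynomial → Set (a ⊔ b ⊔ ℓ)
  Span G v = Σ (List (Carrier × Polynomial)) λ L → All (G ∘ proj₂) L × (v ≋ lincomb L)

  module _ {ℓ} {G : Polynomial → Set ℓ} where

    Span-resp : ∀ v w → v ≋ w → Span G w → Span G v
    Span-resp v w v≋w (L , gens , w≋L) = L , gens , ≋-trans v w (lincomb L) v≋w w≋L

    Span-zero : ∀ v → v ≋ 0P → Span G v
    Span-zero v v≋0 = [] , [] , v≋0

    Span-gen : ∀ v → G v → Span G v
    Span-gen v g = (1# , v) ∷ [] , g ∷ [] , λ α →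
      sym (trans (coeff-+P (scale 1# v) [] α) (trans (+-identityʳ _) (trans (coeff-scale 1# v α) (*-identityˡ _))))

    Span-+P : ∀ v w → Span G v → Span G w → Span G (v +P w)
    Span-+P v w (L , gs , v≋L) (L′ , gs′ , w≋L′) = L ++ L′ , Allₚ.++⁺ gs gs′ , λ α → begin
      coeff (v +P w) α                                                      ≈⟨ +P-cong v (lincomb L) w (lincomb L′) v≋L w≋L′ α ⟩
      coeff (lincomb L +P lincomb L′) α                                     ≈⟨ coeff-+P (lincomb L) (lincomb L′) α ⟩
      coeff (lincomb L) α + coeff (lincomb L′) α                            ≈⟨ +-cong (coeff-lincomb L α) (coeff-lincomb L′ α) ⟩
      sumOver L (λ t → proj₁ t * coeff (proj₂ t) α) + sumOver L′ (λ t → proj₁ t * coeff (proj₂ t) α)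
                                                                            ≈⟨ sumOver-++ L L′ _ ⟨
      sumOver (L ++ L′) (λ t → proj₁ t * coeff (proj₂ t) α)                 ≈⟨ coeff-lincomb (L ++ L′) α ⟨
      coeff (lincomb (L ++ L′)) α                                           ∎

    Span-scale : ∀ c v → Span G v → Span G (scale c v)
    Span-scale c v (L , gs , v≋L) = map (λ (d , u) → c * d , u) L , Allₚ.map⁺ gs , λ α → begin
      coeff (scale c v) α                                                   ≈⟨ coeff-scale c v α ⟩
      c * coeff v α                                                         ≈⟨ *-congˡ (trans (v≋L α) (coeff-lincomb L α)) ⟩
      c * sumOver L (λ t → proj₁ t * coeff (proj₂ t) α)                     ≈⟨ *-distribˡ-sumOver L c _ ⟩
      sumOver L (λ t → c * (proj₁ t * coeff (proj₂ t) α))                   ≈⟨ sumOver-cong L (λ t → sym (*-assoc c _ _)) ⟩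
      sumOver L (λ t → c * proj₁ t * coeff (proj₂ t) α)                     ≡⟨ sumOver-map _ L _ ⟨
      sumOver (map (λ (d , u) → c * d , u) L) (λ t → proj₁ t * coeff (proj₂ t) α)
                                                                            ≈⟨ coeff-lincomb (map (λ (d , u) → c * d , u) L) α ⟨
      coeff (lincomb (map (λ (d , u) → c * d , u) L)) α                     ∎

    Span-lincomb : ∀ L → All (Span G ∘ proj₂) L → Span G (lincomb L)
    Span-lincomb []            []         = Span-zero 0P (λ α → refl)
    Span-lincomb ((c , v) ∷ L) (s ∷ spans) = Span-+P (scale c v) (lincomb L) (Span-scale c v s) (Span-lincomb L spans)

  Span-mono : ∀ {ℓ ℓ′} {G : Polynomial → Set ℓ} {G′ : Polynomial → Set ℓ′} →
              (∀ v → G v → G′ v) → ∀ v → Span G v → Span G′ v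
  Span-mono G⊆G′ v (L , gs , v≋L) = L , All.map (G⊆G′ _) gs , v≋L

  Span-linear : ∀ {ℓ ℓ′} {G : Polynomial → Set ℓ} {G′ : Polynomial → Set ℓ′} {Φ} → IsLinear Φ →
                (∀ v → G v → Span G′ (Φ v)) → ∀ v → Span G v → Span G′ (Φ v)
  Span-linear {G′ = G′} {Φ} lin images v (L , gs , v≋L) =
    Span-resp (Φ v) (lincomb L′) (≋-trans (Φ v) (Φ (lincomb L)) (lincomb L′) (IsLinear.cong lin v (lincomb L) v≋L) (lincomb-homo lin L))
      (Span-lincomb L′ (Allₚ.map⁺ (All.map (images _) gs)))
    where L′ = map (λ (c , v) → c , Φ v) L

  open import Algebra.Properties.Semiring.Sum semiring
    using (sum-syntax; sum-cong-≋; ∑-distrib-+; *-distribˡ-sum)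
  open RowReduction F using (Independent; Independent⇒≤; ∑-zero)

  indicator : ∀ {K} → Fin K → Fin K → Carrier
  indicator zero    zero    = 1#
  indicator zero    (suc _) = 0#
  indicator (suc _) zero    = 0#
  indicator (suc i) (suc k) = indicator i k

  ∑-indicator : ∀ {K} i (f : Fin K → Carrier) → ∑[ k < K ] (indicator i k * f k) ≈ f i
  ∑-indicator zero    f = trans (+-cong (*-identityˡ _) (∑-zero (λ k → 0# * f (suc k)) (λ k → zeroˡ _))) (+-identityʳ _)
  ∑-indicator (suc i) f = trans (+-cong (zeroˡ _) (∑-indicator i (f ∘ suc))) (+-identityˡ _)

  Coordinates : List Polynomial → Polynomial → Set (a ⊔ b)
  Coordinates W v = Σ (Fin (length W) → Carrier) λ A →
    ∀ α → coeff v α ≈ ∑[ k < length W ] (A k * coeff (List.lookup W k) α)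

  Coordinates-lincomb : ∀ W L → All ((_∈ W) ∘ proj₂) L → Coordinates W (lincomb L)
  Coordinates-lincomb W []            []           = (λ _ → 0#) , λ α → sym (∑-zero (λ k → 0# * coeff (List.lookup W k) α) (λ k → zeroˡ _))
  Coordinates-lincomb W ((c , v) ∷ L) (v∈W ∷ L⊆W) = (λ k → c * indicator i k + A k) , λ α → begin
    coeff (scale c v +P lincomb L) α                                  ≈⟨ coeff-+P (scale c v) (lincomb L) α ⟩
    coeff (scale c v) α + coeff (lincomb L) α                         ≈⟨ +-cong (coeff-scale c v α) (coordsL α) ⟩
    c * coeff v α + ∑[ k < K ] (A k * w k α)                          ≈⟨ +-congʳ (*-congˡ (reflexive (≡.cong (λ u → coeff u α) (lookup-index v∈W)))) ⟩
    c * w i α + ∑[ k < K ] (A k * w k α)                              ≈⟨ +-congʳ (*-congˡ (∑-indicator i (λ k → w k α))) ⟨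
    c * ∑[ k < K ] (indicator i k * w k α) + ∑[ k < K ] (A k * w k α) ≈⟨ +-congʳ (*-distribˡ-sum c (λ k → indicator i k * w k α)) ⟩
    ∑[ k < K ] (c * (indicator i k * w k α)) + ∑[ k < K ] (A k * w k α)
                                                                      ≈⟨ ∑-distrib-+ (λ k → c * (indicator i k * w k α)) (λ k → A k * w k α) ⟨
    ∑[ k < K ] (c * (indicator i k * w k α) + A k * w k α)            ≈⟨ sum-cong-≋ (λ k → trans (+-congʳ (sym (*-assoc c (indicator i k) (w k α)))) (sym (distribʳ (w k α) _ _))) ⟩
    ∑[ k < K ] ((c * indicator i k + A k) * w k α)                    ∎
    where
    K = length W
    w : Fin K → Monomial → Carrier
    w k = coeff (List.lookup W k)
    i = Any.index v∈W
    A = proj₁ (Coordinates-lincomb W L L⊆W)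
    coordsL = proj₂ (Coordinates-lincomb W L L⊆W)

  Span⇒Coordinates : ∀ W v → Span (_∈ W) v → Coordinates W v
  Span⇒Coordinates W v (L , L⊆W , v≋L) =
    let (A , coords) = Coordinates-lincomb W L L⊆W in A , λ α → trans (v≋L α) (coords α)

  coordinateRows : ∀ W {vs} → All (Coordinates W) vs → Fin (length vs) → Fin (length W) → Carrier
  coordinateRows W (c ∷ cs) zero    = proj₁ c
  coordinateRows W (c ∷ cs) (suc j) = coordinateRows W cs j

  coeff-lincomb-tabulate : ∀ W {vs} (cs : All (Coordinates W) vs) (d : Fin (length vs) → Carrier) α →
    coeff (lincomb (List.zip (List.tabulate d) vs)) α
      ≈ ∑[ k < length W ] (∑[ j < length vs ] (d j * coordinateRows W cs j k) * coeff (List.lookup W k) α)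
  coeff-lincomb-tabulate W []                  d α = sym (∑-zero (λ k → 0# * coeff (List.lookup W k) α) (λ k → zeroˡ _))
  coeff-lincomb-tabulate W {v ∷ vs} ((A , coords) ∷ cs) d α = begin
    coeff (scale (d zero) v +P lincomb (List.zip (List.tabulate (d ∘ suc)) vs)) α
                                                       ≈⟨ coeff-+P (scale (d zero) v) _ α ⟩
    coeff (scale (d zero) v) α + coeff (lincomb (List.zip (List.tabulate (d ∘ suc)) vs)) α
                                                       ≈⟨ +-cong (coeff-scale (d zero) v α) (coeff-lincomb-tabulate W cs (d ∘ suc) α) ⟩
    d zero * coeff v α + ∑[ k < K ] (S k * w k)        ≈⟨ +-congʳ (*-congˡ (coords α)) ⟩
    d zero * ∑[ k < K ] (A k * w k) + ∑[ k < K ] (S k * w k)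
                                                       ≈⟨ +-congʳ (*-distribˡ-sum (d zero) (λ k → A k * w k)) ⟩
    ∑[ k < K ] (d zero * (A k * w k)) + ∑[ k < K ] (S k * w k)
                                                       ≈⟨ ∑-distrib-+ (λ k → d zero * (A k * w k)) (λ k → S k * w k) ⟨
    ∑[ k < K ] (d zero * (A k * w k) + S k * w k)      ≈⟨ sum-cong-≋ (λ k → trans (+-congʳ (sym (*-assoc (d zero) (A k) (w k))))
                                                                                  (sym (distribʳ (w k) _ _))) ⟩
    ∑[ k < K ] ((d zero * A k + S k) * w k)            ∎
    where
    K = length W
    w : Fin K → Carrier
    w k = coeff (List.lookup W k) α
    S : Fin K → Carrier
    S k = ∑[ j < length vs ] (d (suc j) * coordinateRows W cs j k)

  Span⇒length-≤ : ∀ W vs → All (Span (_∈ W)) vs → LinIndep vs → ¬ ¬ (length vs ≤ length W)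
  Span⇒length-≤ W vs spans independent = Independent⇒≤ (coordinateRows W cs) rowsIndependent
    where
    cs : All (Coordinates W) vs
    cs = All.map (λ {v} → Span⇒Coordinates W v) spans
    rowsIndependent : Independent (coordinateRows W cs)
    rowsIndependent d dependent = Allₚ.tabulate⁻ (independent (List.tabulate d) (Listₚ.length-tabulate d) λ α →
      trans (coeff-lincomb-tabulate W cs d α)
            (∑-zero (λ k → ∑[ j < length vs ] (d j * coordinateRows W cs j k) * coeff (List.lookup W k) α)
                    (λ k → trans (*-congʳ (dependent k)) (zeroˡ _))))

module Normalisation {a b} (F : Field a b) (N : ℕ) where
  open Field F hiding (zero)
  open FieldSums F
  open PolynomialCalculus F N

  GoodMonomial : (s d : ℕ) → Monomial → Set
  GoodMonomial s d β = Vec.sum β ≡ d × #nonzero β ≤ s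

  goodMonomial? : ∀ s d → Decidable (GoodMonomial s d)
  goodMonomial? s d β = (Vec.sum β Nat.≟ d) ×-dec (#nonzero β Nat.≤? s)

  -- #nonzero is supportSize freed from the parameters of Poly.
  supportSize≡#nonzero : ∀ {k} (v : Vec ℕ k) → supportSize v ≡ #nonzero v
  supportSize≡#nonzero Vec.[]             = ≡.refl
  supportSize≡#nonzero (zero  Vec.∷ v)    = supportSize≡#nonzero v
  supportSize≡#nonzero (suc _ Vec.∷ v)    = ≡.cong suc (supportSize≡#nonzero v)

  -- A polynomial is a list of terms that may cancel, so homogeneity and the support bound constrain only its
  -- coefficients; normalising discards the terms whose exponent violates them.
  normalise : (s d : ℕ) → Polynomial → Polynomial
  normalise s d = List.filter (goodMonomial? s d ∘ proj₁)

  normalise-good : ∀ s d q → All (GoodMonomial s d ∘ proj₁) (normalise s d q)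
  normalise-good s d q = Allₚ.all-filter (goodMonomial? s d ∘ proj₁) q

  normalise-≋ : ∀ s d q → IsHomogeneous d q → SupportAtMost s q → ¬ ¬ (q ≋ normalise s d q)
  normalise-≋ s d q homogeneous sparse = ¬¬-map (λ classified α → coeff-normalise α classified) (¬¬-All q λ _ → ¬¬-excluded-middle)
    where
    nonzero⇒good : ∀ α → ¬ coeff q α ≈ 0# → GoodMonomial s d α
    nonzero⇒good α nz = homogeneous α nz , ≡.subst (_≤ s) (supportSize≡#nonzero α) (sparse α nz)
    coeff-normalise : ∀ α → All (λ t → Dec (coeff q (proj₁ t) ≈ 0#)) q → coeff q α ≈ coeff (normalise s d q) α
    coeff-normalise α classified with goodMonomial? s d α
    ... | yes good = trans (coeff-sumOver q α) (sym (trans (coeff-sumOver (normalise s d q) α)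
                       (sumOver-filter _ q _ λ (β , c) bad → reflexive (termCoeff-≢ β c (λ β≡α → bad (≡.subst _ (≡.sym β≡α) good))))))
    ... | no bad = trans coeff≈0 (sym (trans (coeff-sumOver (normalise s d q) α)
                     (sumOver-All-zero _ (normalise-good s d q) λ (β , c) good → reflexive (termCoeff-≢ β c (λ β≡α → bad (≡.subst _ β≡α good))))))
      where
      coeff≈0 : coeff q α ≈ 0#
      coeff≈0 with any? (λ t → Vecₚ.≡-dec Nat._≟_ (proj₁ t) α) q
      ... | yes α∈q = occurs classified α∈q
        where
        occurrence : ∀ β → Dec (coeff q β ≈ 0#) → β ≡ α → coeff q α ≈ 0#
        occurrence β (yes c≈0) ≡.refl = c≈0
        occurrence β (no c≉0)  ≡.refl = ⊥-elim (bad (nonzero⇒good α c≉0))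
        occurs : ∀ {ts} → All (λ t → Dec (coeff q (proj₁ t) ≈ 0#)) ts → Any (λ t → proj₁ t ≡ α) ts → coeff q α ≈ 0#
        occurs (dec ∷ _)    (here β≡α)   = occurrence _ dec β≡α
        occurs (_   ∷ decs) (there α∈ts) = occurs decs α∈ts
      ... | no α∉q = trans (coeff-sumOver q α) (sumOver-All-zero _ (Allₚ.¬Any⇒All¬ q α∉q) λ (β , c) β≢α → reflexive (termCoeff-≢ β c β≢α))

  Factors : Set a
  Factors = List (ℕ × Polynomial)

  normaliseFactors : ℕ → Factors → Factors
  normaliseFactors s = map (λ (d , q) → d , normalise s d q)

  GoodFactor : ℕ → ℕ × Polynomial → Set a
  GoodFactor s (d , q) = All (GoodMonomial s d ∘ proj₁) q

  normaliseFactors-good : ∀ s Qs → All (GoodFactor s) (normaliseFactors s Qs)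
  normaliseFactors-good s Qs = Allₚ.map⁺ (All.universal (λ (d , q) → normalise-good s d q) Qs)

  normaliseFactors-degrees : ∀ s Qs → map proj₁ (normaliseFactors s Qs) ≡ map proj₁ Qs
  normaliseFactors-degrees s Qs = ≡.sym (Listₚ.map-∘ Qs)

  normaliseFactors-≋ : ∀ s Qs → All (λ (d , q) → IsHomogeneous d q × SupportAtMost s q) Qs →
                       ¬ ¬ (prodP (map proj₂ Qs) ≋ prodP (map proj₂ (normaliseFactors s Qs)))
  normaliseFactors-≋ s []             []                         = ¬¬-intro (λ α → refl)
  normaliseFactors-≋ s ((d , q) ∷ Qs) ((homogeneous , sparse) ∷ hs) =
    normalise-≋ s d q homogeneous sparse ¬¬>>= λ q≋ →
    ¬¬-map (*P-cong q (normalise s d q) (prodP (map proj₂ Qs)) (prodP (map proj₂ (normaliseFactors s Qs))) q≋)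
           (normaliseFactors-≋ s Qs hs)

open import Data.Nat using (_+_; _*_; _^_; _∸_)

module ProductDerivatives {a b} (F : Field a b) (N : ℕ) (s : ℕ) where
  open Field F using (0#; 1#; refl; sym; trans; reflexive; +-identityʳ)
  open PolynomialCalculus F N
  open Spans F N
  open Normalisation F N using (Factors; GoodFactor; GoodMonomial)

  -- The terms of ∂ applied to the product of the factors unselected by σ: E = x^β · ∏_{i ∉ σ′} Qᵢ, where σ′ selects
  -- one more factor, of degree deg β + 1.
  record OneMoreSelected (Qs : Factors) (σ : List Bool) (E : Polynomial) : Set a where
    constructor oneMore
    field
      β          : Monomial
      σ′         : List Bool
      form       : E ≡ mono β *P prodP (unselected σ′ Qs)
      admissible : Admissible σ′ Qs
      count      : #selected σ′ ≡ suc (#selected σ)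
      degree     : Vec.sum β + suc (selectedDegree σ Qs) ≡ selectedDegree σ′ Qs
      support    : #nonzero β ≤ s

  ∂-1P : ∀ x → ∂ x 1P ≋ 0P
  ∂-1P x α = trans (coeff-sumOver (∂ x 1P) α) (trans (+-identityʳ _)
    (termCoeff-zero (lower (Vec.replicate N 0) x) α (reflexive (≡.cong (λ k → natMul k 1#) (Vecₚ.lookup-replicate x 0)))))

  Span-∂ₜ-*P : ∀ {ℓ} {G : Polynomial → Set ℓ} x β c R →
               (∀ {k} → Vec.lookup β x ≡ suc k → G (mono (lower β x) *P R)) → Span G ((∂ₜ x (β , c) ∷ []) *P R)
  Span-∂ₜ-*P x β c R gen with Vec.lookup β x
  ... | zero  = Span-zero (((lower β x , 0#) ∷ []) *P R)
                  (≋-trans (((lower β x , 0#) ∷ []) *P R) (scale 0# (mono (lower β x) *P R)) 0P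
                    (singleton-*P (lower β x) 0# R) (scale-zero (mono (lower β x) *P R) refl))
  ... | suc k = Span-resp (((lower β x , natMul (suc k) c) ∷ []) *P R) (scale (natMul (suc k) c) (mono (lower β x) *P R))
                  (singleton-*P (lower β x) _ R)
                  (Span-scale (natMul (suc k) c) (mono (lower β x) *P R) (Span-gen (mono (lower β x) *P R) (gen ≡.refl)))

  Span-∂-*P : ∀ x d σ qs q → Admissible σ qs → ∀ ts → All (GoodMonomial s d ∘ proj₁) ts →
              Span (OneMoreSelected ((d , q) ∷ qs) (false ∷ σ)) (∂ x ts *P prodP (unselected σ qs))
  Span-∂-*P x d σ qs q adm []            []                          = Span-zero [] (λ α → refl)
  Span-∂-*P x d σ qs q adm ((β , c) ∷ ts) ((β-degree , β-support) ∷ good) =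
    Span-resp (∂ x ((β , c) ∷ ts) *P R) (((∂ₜ x (β , c) ∷ []) *P R) +P (∂ x ts *P R)) (∷-*P (∂ₜ x (β , c)) (∂ x ts) R)
      (Span-+P ((∂ₜ x (β , c) ∷ []) *P R) (∂ x ts *P R) (Span-∂ₜ-*P x β c R selectβ) (Span-∂-*P x d σ qs q adm ts good))
    where
    R = prodP (unselected σ qs)
    selectβ : ∀ {k} → Vec.lookup β x ≡ suc k → OneMoreSelected ((d , q) ∷ qs) (false ∷ σ) (mono (lower β x) *P R)
    selectβ βₓ≡ = oneMore (lower β x) (true ∷ σ) ≡.refl (≡.subst (1 ≤_) lowered (s≤s z≤n) , adm) ≡.refl
      (≡.trans (ℕₚ.+-suc _ _) (≡.cong (_+ selectedDegree σ qs) lowered))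
      (ℕₚ.≤-trans (#nonzero-lower β x) β-support)
      where
      lowered : suc (Vec.sum (lower β x)) ≡ d
      lowered = ≡.trans (sum-lower β x βₓ≡) β-degree

  ∂-unselected : ∀ x qs σ → All (GoodFactor s) qs → Admissible σ qs →
                 Span (OneMoreSelected qs σ) (∂ x (prodP (unselected σ qs)))
  ∂-unselected x []             []          []         _           = Span-zero (∂ x 1P) (∂-1P x)
  ∂-unselected x ((d , q) ∷ qs) (true  ∷ σ) (_ ∷ good) (1≤d , adm) =
    Span-mono select (∂ x (prodP (unselected σ qs))) (∂-unselected x qs σ good adm)
    where
    shift : ∀ b d m → b + suc (d + m) ≡ d + (b + suc m)
    shift = solve-∀
    select : ∀ E → OneMoreSelected qs σ E → OneMoreSelected ((d , q) ∷ qs) (true ∷ σ) E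
    select E (oneMore β σ′ form adm′ count degree support) =
      oneMore β (true ∷ σ′) form (1≤d , adm′) (≡.cong suc count) (≡.trans (shift _ d _) (≡.cong (d +_) degree)) support
  ∂-unselected x ((d , q) ∷ qs) (false ∷ σ) (q-good ∷ good) adm =
    Span-resp (∂ x (q *P R)) ((∂ x q *P R) +P (q *P ∂ x R)) (∂-*P x q R)
      (Span-+P (∂ x q *P R) (q *P ∂ x R) (Span-∂-*P x d σ qs q adm q q-good)
        (Span-linear (*P-isLinearʳ q) keep (∂ x R) (∂-unselected x qs σ good adm)))
    where
    R = prodP (unselected σ qs)
    keep : ∀ E → OneMoreSelected qs σ E → Span (OneMoreSelected ((d , q) ∷ qs) (false ∷ σ)) (q *P E)
    keep E (oneMore β σ′ ≡.refl adm′ count degree support) =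
      Span-resp (q *P (mono β *P R′)) (mono β *P (q *P R′)) (*P-mono-comm q β R′)
        (Span-gen (mono β *P (q *P R′)) (oneMore β (false ∷ σ′) ≡.refl adm′ count degree support))
      where R′ = prodP (unselected σ′ qs)

  module _ (Qs : Factors) (good : All (GoodFactor s) Qs) where

    -- The shape of an order-j derivative of ∏ Qs: the selected factors have been differentiated away into x^μ.
    record Shape (j : ℕ) (E : Polynomial) : Set a where
      constructor shape
      field
        μ          : Monomial
        σ          : List Bool
        form       : E ≡ mono μ *P prodP (unselected σ Qs)
        admissible : Admissible σ Qs
        count      : #selected σ ≤ j
        degree     : Vec.sum μ + j ≡ selectedDegree σ Qs
        support    : #nonzero μ ≤ s * #selected σ

    ∂-Shape : ∀ x j E → Shape j E → Span (Shape (suc j)) (∂ x E)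
    ∂-Shape x j E (shape μ σ ≡.refl adm count degree support) =
      Span-resp (∂ x (mono μ *P R)) ((∂ x (mono μ) *P R) +P (mono μ *P ∂ x R)) (∂-*P x (mono μ) R)
        (Span-+P (∂ x (mono μ) *P R) (mono μ *P ∂ x R) (Span-∂ₜ-*P x μ 1# R lowerμ)
          (Span-linear (*P-isLinearʳ (mono μ)) absorb (∂ x R) (∂-unselected x Qs σ good adm)))
      where
      R = prodP (unselected σ Qs)
      lowerμ : ∀ {k} → Vec.lookup μ x ≡ suc k → Shape (suc j) (mono (lower μ x) *P R)
      lowerμ μₓ≡ = shape (lower μ x) σ ≡.refl adm (ℕₚ.m≤n⇒m≤1+n count)
        (≡.trans (ℕₚ.+-suc _ j) (≡.trans (≡.cong (_+ j) (sum-lower μ x μₓ≡)) degree))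
        (ℕₚ.≤-trans (#nonzero-lower μ x) support)
      shift : ∀ m b j → (m + b) + suc j ≡ b + suc (m + j)
      shift = solve-∀
      absorb : ∀ E → OneMoreSelected Qs σ E → Span (Shape (suc j)) (mono μ *P E)
      absorb E (oneMore β σ′ ≡.refl adm′ count′ degree′ support′) =
        Span-resp (mono μ *P (mono β *P R′)) (mono (μ ⊕ β) *P R′) (mono-*P-mono μ β R′)
          (Span-gen (mono (μ ⊕ β) *P R′) (shape (μ ⊕ β) σ′ ≡.refl adm′ (≡.subst (_≤ suc j) (≡.sym count′) (s≤s count))
            μβ-degree μβ-support))
        where
        R′ = prodP (unselected σ′ Qs)
        μβ-degree : Vec.sum (μ ⊕ β) + suc j ≡ selectedDegree σ′ Qs
        μβ-degree = begin
          Vec.sum (μ ⊕ β) + suc j                   ≡⟨ ≡.cong (_+ suc j) (sum-⊕ μ β) ⟩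
          (Vec.sum μ + Vec.sum β) + suc j           ≡⟨ shift (Vec.sum μ) (Vec.sum β) j ⟩
          Vec.sum β + suc (Vec.sum μ + j)           ≡⟨ ≡.cong (λ k → Vec.sum β + suc k) degree ⟩
          Vec.sum β + suc (selectedDegree σ Qs)     ≡⟨ degree′ ⟩
          selectedDegree σ′ Qs                      ∎
          where open ≡.≡-Reasoning
        μβ-support : #nonzero (μ ⊕ β) ≤ s * #selected σ′
        μβ-support = begin
          #nonzero (μ ⊕ β)                ≤⟨ #nonzero-⊕ μ β ⟩
          #nonzero μ + #nonzero β         ≤⟨ ℕₚ.+-mono-≤ support support′ ⟩
          s * #selected σ + s             ≡⟨ ℕₚ.+-comm _ s ⟩
          s + s * #selected σ             ≡⟨ ℕₚ.*-suc s (#selected σ) ⟨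
          s * suc (#selected σ)           ≡⟨ ≡.cong (s *_) count′ ⟨
          s * #selected σ′                ∎
          where open ℕₚ.≤-Reasoning

    ∂*-Shape : ∀ {j} (is : Vec (Fin N) j) → Span (Shape j) (∂* is (prodP (map proj₂ Qs)))
    ∂*-Shape Vec.[] = Span-resp (prodP (map proj₂ Qs)) (mono 𝟘 *P R₀) Q≋ (Span-gen (mono 𝟘 *P R₀) start)
      where
      𝟘 = Vec.replicate N 0
      R₀ = prodP (unselected (none Qs) Qs)
      Q≋ : prodP (map proj₂ Qs) ≋ (mono 𝟘 *P R₀)
      Q≋ α = sym (trans (mono-identity R₀ α) (reflexive (≡.cong (λ Ps → coeff (prodP Ps) α) (unselected-none Qs))))
      start : Shape 0 (mono 𝟘 *P R₀)
      start = shape 𝟘 (none Qs) ≡.refl (admissible-none Qs) (ℕₚ.≤-reflexive (#selected-none Qs))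
        (≡.trans (ℕₚ.+-identityʳ _) (≡.trans (sum-zeros N) (≡.sym (selectedDegree-none Qs))))
        (≡.subst (_≤ s * #selected (none Qs)) (≡.sym (#nonzero-zeros N)) z≤n)
    ∂*-Shape (i Vec.∷ is) = Span-linear (∂-isLinear i) (λ E → ∂-Shape i _ E) (∂* is (prodP (map proj₂ Qs))) (∂*-Shape is)

module ShiftedPartials {a b} (F : Field a b) (N n m r s ℓ : ℕ)
    (1≤r : 1 ≤ r) (2K≤N : 2 * (m + r * s) ≤ N) (2K≤ℓ : 2 * (m + r * s) ≤ ℓ)
    (Qs : Normalisation.Factors F N) (good : All (Normalisation.GoodFactor F N s) Qs) (degrees : sum (map proj₁ Qs) ≡ n)
    where
  open Field F using (Carrier)
  open PolynomialCalculus F N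
  open Spans F N
  open ProductDerivatives F N s

  K L : ℕ
  K = m + r * s
  L = ℓ + n ∸ r

  Q : Polynomial
  Q = prodP (map proj₂ Qs)

  -- W consists of the x^ν · ∏_{i ∉ σ} Qᵢ over the selections σ of total degree at least r, the exponents ν of
  -- degree ℓ + Σ_{i ∈ σ} dᵢ − r and the support sizes between m and m + rs.
  relevant : List (List Bool)
  relevant = List.filter (λ σ → r ≤? selectedDegree σ Qs) (selections Qs r)

  degreeOf : List Bool → ℕ
  degreeOf σ = ℓ + selectedDegree σ Qs ∸ r

  supportSizes : List ℕ
  supportSizes = map (m +_) (downFrom (suc (r * s)))

  generator : List Bool → Monomial → Polynomial
  generator σ ν = mono ν *P prodP (unselected σ Qs)

  generators : List Bool → List Polynomial
  generators σ = concatMap (λ t → map (generator σ) (monomials N t (degreeOf σ))) supportSizes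

  W : List Polynomial
  W = concatMap generators relevant

  ∈-W : ∀ γ → Vec.sum γ ≡ ℓ → #nonzero γ ≡ m → ∀ {E} (sh : Shape Qs good r E) →
        generator (Shape.σ sh) (γ ⊕ Shape.μ sh) ∈ W
  ∈-W γ γ-degree γ-support (shape μ σ _ adm count degree support) =
    ∈-concatMap⁺ generators (lose σ-relevant
      (∈-concatMap⁺ (λ t → map (generator σ) (monomials N t (degreeOf σ))) (lose t-size
        (∈-map⁺ (generator σ) ν-monomial))))
    where
    σ-relevant : σ ∈ relevant
    σ-relevant = ∈-filter⁺ (λ σ → r ≤? selectedDegree σ Qs) (∈-selections Qs σ r adm count)
                   (≡.subst (r ≤_) degree (ℕₚ.m≤n+m r (Vec.sum μ)))
    ν = γ ⊕ μ
    t = #nonzero ν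
    m≤t : m ≤ t
    m≤t = ≡.subst (_≤ t) γ-support (#nonzero-⊕ˡ γ μ)
    t≤K : t ≤ m + r * s
    t≤K = begin
      #nonzero (γ ⊕ μ)          ≤⟨ #nonzero-⊕ γ μ ⟩
      #nonzero γ + #nonzero μ   ≡⟨ ≡.cong (_+ #nonzero μ) γ-support ⟩
      m + #nonzero μ            ≤⟨ ℕₚ.+-monoʳ-≤ m (ℕₚ.≤-trans support (ℕₚ.*-monoʳ-≤ s count)) ⟩
      m + s * r                 ≡⟨ ≡.cong (m +_) (ℕₚ.*-comm s r) ⟩
      m + r * s                 ∎
      where open ℕₚ.≤-Reasoning
    t-size : t ∈ supportSizes
    t-size = ≡.subst (_∈ supportSizes) (ℕₚ.m+[n∸m]≡n m≤t)
      (∈-map⁺ (m +_) (∈-downFrom⁺ (s≤s (ℕₚ.≤-trans (ℕₚ.∸-monoˡ-≤ m t≤K) (ℕₚ.≤-reflexive (ℕₚ.m+n∸m≡n m (r * s)))))))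
    ν-degree : Vec.sum ν ≡ degreeOf σ
    ν-degree = begin
      Vec.sum (γ ⊕ μ)                       ≡⟨ sum-⊕ γ μ ⟩
      Vec.sum γ + Vec.sum μ                 ≡⟨ ≡.cong (_+ Vec.sum μ) γ-degree ⟩
      ℓ + Vec.sum μ                         ≡⟨ ℕₚ.m+n∸n≡m (ℓ + Vec.sum μ) r ⟨
      ℓ + Vec.sum μ + r ∸ r                 ≡⟨ ≡.cong (_∸ r) (ℕₚ.+-assoc ℓ (Vec.sum μ) r) ⟩
      ℓ + (Vec.sum μ + r) ∸ r               ≡⟨ ≡.cong (λ k → ℓ + k ∸ r) degree ⟩
      ℓ + selectedDegree σ Qs ∸ r           ∎
      where open ≡.≡-Reasoning
    ν-monomial : ν ∈ monomials N t (degreeOf σ)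
    ν-monomial = ≡.subst (λ D → ν ∈ monomials N t D) ν-degree (∈-monomials ν)

  InShiftedSpan⇒Span : ∀ P → P ≋ Q → ∀ v → InShiftedSpan r ℓ m P v → Span (_∈ W) v
  InShiftedSpan⇒Span P P≋Q v (terms , conditions , v≋) =
    Span-resp v (lincomb shifted) v≋ (Span-lincomb shifted (Allₚ.map⁺ (All.map (λ {t} → shifted-∈ t) conditions)))
    where
    shifted = map (λ (c , γ , is) → c , mono γ *P ∂* is P) terms
    shifted-∈ : ∀ ((c , γ , is) : Carrier × Monomial × Vec (Fin N) r) → Vec.sum γ ≡ ℓ × supportSize γ ≡ m →
                Span (_∈ W) (mono γ *P ∂* is P)
    shifted-∈ (_ , γ , is) (γ-degree , γ-support) =
      Span-resp (mono γ *P ∂* is P) (mono γ *P ∂* is Q) (*P-congʳ (mono γ) (∂* is P) (∂* is Q) (∂*-cong is P Q P≋Q))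
        (Span-linear (*P-isLinearʳ (mono γ)) absorb (∂* is Q) (∂*-Shape Qs good is))
      where
      absorb : ∀ E → Shape Qs good r E → Span (_∈ W) (mono γ *P E)
      absorb E sh@(shape μ σ ≡.refl _ _ _ _) =
        Span-resp (mono γ *P E) (generator σ (γ ⊕ μ)) (mono-*P-mono γ μ (prodP (unselected σ Qs)))
          (Span-gen (generator σ (γ ⊕ μ)) (∈-W γ γ-degree (≡.trans (≡.sym (Normalisation.supportSize≡#nonzero F N γ)) γ-support) sh))

  length-generators : ∀ σ → σ ∈ relevant → length (generators σ) ≤ (1 + n * r * s) * (binomial N K * binomial L K)
  length-generators σ σ-relevant =
    ℕₚ.≤-trans (length-concatMap-≤-* (λ t → map (generator σ) (monomials N t D)) _ supportSizes length-for)
               (ℕₚ.*-monoˡ-≤ _ #supportSizes)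
    where
    r≤d : r ≤ selectedDegree σ Qs
    r≤d = proj₂ (∈-filter⁻ (λ σ → r ≤? selectedDegree σ Qs) {xs = selections Qs r} σ-relevant)
    d≤n : selectedDegree σ Qs ≤ n
    d≤n = ≡.subst (selectedDegree σ Qs ≤_) degrees (selectedDegree-≤ σ Qs)
    1≤n : 1 ≤ n
    1≤n = ℕₚ.≤-trans 1≤r (ℕₚ.≤-trans r≤d d≤n)
    #supportSizes : length supportSizes ≤ 1 + n * r * s
    #supportSizes = ≡.subst (_≤ 1 + n * r * s)
      (≡.sym (≡.trans (Listₚ.length-map (m +_) (downFrom (suc (r * s)))) (Listₚ.length-downFrom (suc (r * s)))))
      (s≤s (ℕₚ.*-monoˡ-≤ s (≡.subst (_≤ n * r) (ℕₚ.*-identityˡ r) (ℕₚ.*-monoˡ-≤ r 1≤n))))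
    D = degreeOf σ
    2K≤D : 2 * K ≤ D
    2K≤D = ℕₚ.≤-trans 2K≤ℓ (≡.subst (ℓ ≤_) (≡.sym (ℕₚ.+-∸-assoc ℓ r≤d)) (ℕₚ.m≤m+n ℓ _))
    D≤L : D ≤ L
    D≤L = ℕₚ.∸-monoˡ-≤ r (ℕₚ.+-monoʳ-≤ ℓ d≤n)
    length-for : ∀ t → t ∈ supportSizes → length (map (generator σ) (monomials N t D)) ≤ binomial N K * binomial L K
    length-for t t-size with ∈-map⁻ (m +_) t-size
    ... | u , u< , ≡.refl = begin
      length (map (generator σ) (monomials N (m + u) D))   ≡⟨ Listₚ.length-map _ (monomials N (m + u) D) ⟩
      length (monomials N (m + u) D)                       ≤⟨ length-monomials N (m + u) D ⟩
      binomial N (m + u) * binomial D (m + u)              ≤⟨ ℕₚ.*-mono-≤ (binomial-monoʳ-≤ t≤K 2K≤N)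
                                                                 (ℕₚ.≤-trans (binomial-monoʳ-≤ t≤K 2K≤D) (binomial-monoˡ-≤ K D≤L)) ⟩
      binomial N K * binomial L K                          ∎
      where
      open ℕₚ.≤-Reasoning
      t≤K : m + u ≤ K
      t≤K = ℕₚ.+-monoʳ-≤ m (ℕₚ.≤-pred (∈-downFrom⁻ u<))

  length-W : length W ≤ binomial (n + r) r * ((1 + n * r * s) * (binomial N K * binomial L K))
  length-W = ℕₚ.≤-trans (length-concatMap-≤-* generators _ relevant length-generators) (ℕₚ.*-monoˡ-≤ _ #relevant)
    where
    #relevant : length relevant ≤ binomial (n + r) r
    #relevant = ℕₚ.≤-trans (Listₚ.length-filter (λ σ → r ≤? selectedDegree σ Qs) (selections Qs r))
                           (≡.subst (λ d → length (selections Qs r) ≤ binomial (d + r) r) degrees (length-selections Qs r))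

shiftedPartials-dimension : ∀ {a b} (F : Field a b) (N n m r s ℓ : ℕ) →
  1 ≤ r → 2 * (m + r * s) ≤ N → 2 * (m + r * s) ≤ ℓ →
  (Qs : List (ℕ × Poly.Polynomial F N)) →
  All (λ (d , Q) → Poly.IsHomogeneous F N d Q × Poly.SupportAtMost F N s Q) Qs →
  sum (map proj₁ Qs) ≡ n →
  Poly.DimAtMost F N (Poly.InShiftedSpan F N r ℓ m (Poly.prodP F N (map proj₂ Qs)))
    (binomial (n + r) r * ((1 + n * r * s) * (binomial N (m + r * s) * binomial (ℓ + n ∸ r) (m + r * s))))
shiftedPartials-dimension F N n m r s ℓ 1≤r 2K≤N 2K≤ℓ Qs homogeneous degrees vs inSpan independent =
  decidable-stable (_ ≤? _) (normaliseFactors-≋ s Qs homogeneous ¬¬>>= λ Q≋Q′ →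
    ¬¬-map (λ ≤W → ℕₚ.≤-trans ≤W length-W)
      (Span⇒length-≤ W vs (All.map (λ {v} → InShiftedSpan⇒Span _ Q≋Q′ v) inSpan) independent))
  where
  open Normalisation F N
  open Spans F N using (Span⇒length-≤)
  open ShiftedPartials F N n m r s ℓ 1≤r 2K≤N 2K≤ℓ (normaliseFactors s Qs) (normaliseFactors-good s Qs)
         (≡.trans (≡.cong sum (normaliseFactors-degrees s Qs)) degrees)

lemma4p1 : ∀ {a b} → ∃₂ λ (c k : ℕ) →
  (F : Field a b) (N n m r s ℓ : ℕ) →
  1 ≤ m → 1 ≤ r → 1 ≤ s → 1 ≤ ℓ →
  2 * (m + r * s) ≤ N → 2 * (m + r * s) ≤ ℓ →
  (Qs : List (ℕ × Poly.Polynomial F N)) →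
  All (λ dQ → Poly.IsHomogeneous F N (proj₁ dQ) (proj₂ dQ) × Poly.SupportAtMost F N s (proj₂ dQ)) Qs →
  sum (map proj₁ Qs) ≡ n →
  Poly.DimAtMost F N
    (Poly.InShiftedSpan F N r ℓ m (Poly.prodP F N (map proj₂ Qs)))
    (c * (1 + n * r * s) ^ k * ((n + r) C r) * (N C (m + r * s)) * ((ℓ + n ∸ r) C (m + r * s)))
lemma4p1 = 1 , 1 , λ F N n m r s ℓ _ 1≤r _ _ 2K≤N 2K≤ℓ Qs homogeneous degrees vs inSpan independent →
  ℕₚ.≤-trans (shiftedPartials-dimension F N n m r s ℓ 1≤r 2K≤N 2K≤ℓ Qs homogeneous degrees vs inSpan independent)
    (ℕₚ.≤-reflexive (bound-in-C n r s N (m + r * s) (ℓ + n ∸ r)))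
  where
  reassociate : ∀ p x y z → x * (p * (y * z)) ≡ 1 * (p * 1) * x * y * z
  reassociate = solve-∀
  bound-in-C : ∀ n r s N K L → binomial (n + r) r * ((1 + n * r * s) * (binomial N K * binomial L K))
                              ≡ 1 * (1 + n * r * s) ^ 1 * ((n + r) C r) * (N C K) * (L C K)
  bound-in-C n r s N K L rewrite binomial≡C (n + r) r | binomial≡C N K | binomial≡C L K =
    reassociate (1 + n * r * s) ((n + r) C r) (N C K) (L C K)
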